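{- For $l\ge1$ and $m\ge2$, \[ X_{P_l}X_{C_m}=\sum_{I\vDash l,\ J\vDash m}j_1\,w_{IJ}\,e_{IJ}=\sum_{\substack{K\vDash l+m\\ \Theta_K^+(l)=0}}\bigl(\Theta_K^+(l+1)+1\bigr)w_K\,e_K, \] where $j_1$ is the first part of $J$ and $IJ$ is the concatenation of $I$ and $J$.
   Context: $P_l$ is the path on $l$ vertices, $C_m$ the cycle on $m$ vertices ($C_2$: two vertices joined by an edge). A composition $I=i_1\cdots i_s\vDash n$ is a sequence of positive integers with sum $n$; $e_I=e_{i_1}\cdots e_{i_s}$ (elementary symmetric functions); $w_I=i_1\prod_{j\ge2}(i_j-1)$. For $0\le c\le n$, $\sigma_I^+(c)=\min\{i_1+\dots+i_k:0\le k\le s,\ i_1+\dots+i_k\ge c\}$ and $\Theta_I^+(c)=\sigma_I^+(c)-c$. The chromatic symmetric function is $X_G=\sum_\kappa\prod_vx_{\kappa(v)}$ over proper colorings $\kappa:V(G)\to\{1,2,\dots\}$. -}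

module Defs where

open import Data.Bool using (Bool; true; false; _∧_; _∨_; not; if_then_else_)
open import Data.Nat using (ℕ; zero; suc; _+_; _*_; _∸_; _⊓_; _≡ᵇ_; _≤ᵇ_)
open import Data.Fin using (Fin; toℕ)
open import Data.Vec using (Vec; []; _∷_; lookup; tabulate; zipWith; countᵇ)
import Data.Vec as V
open import Data.List using (List; []; _∷_; [_]; map; concatMap; filterᵇ; length; upTo; allFin; _++_; foldr)
open import Data.Nat.ListAction using (sum; product)
open import Data.Bool.ListAction using (and)

-- Formal power series in the variables x_0, x_1, ... (restricted to the
-- first N variables), with ℕ coefficients, given by their coefficient
-- function on exponent vectors  α : Vec ℕ N  (monomial x^α).
-- Two symmetric functions are equal iff their coefficients agree on
-- every monomial; each monomial only involves finitely many variables.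

Series : ℕ → Set
Series N = Vec ℕ N → ℕ

below : ∀ {N} → Vec ℕ N → List (Vec ℕ N)
below []      = [ [] ]
below (a ∷ α) = concatMap (λ b → map (b ∷_) (below α)) (upTo (suc a))

_⊕_ : ∀ {N} → Series N → Series N → Series N
(f ⊕ g) α = f α + g α

_⊛_ : ∀ {N} → Series N → Series N → Series N
(f ⊛ g) α = sum (map (λ β → f β * g (zipWith _∸_ α β)) (below α))

_·_ : ∀ {N} → ℕ → Series N → Series N
(c · f) α = c * f α

zeroS : ∀ {N} → Series N
zeroS α = 0

sumS : ∀ {N} → List (Series N) → Series N
sumS = foldr _⊕_ zeroS

allZero : ∀ {N} → Vec ℕ N → Bool
allZero []      = true
allZero (a ∷ α) = (a ≡ᵇ 0) ∧ allZero α

allBinary : ∀ {N} → Vec ℕ N → Bool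
allBinary []      = true
allBinary (a ∷ α) = (a ≤ᵇ 1) ∧ allBinary α

oneS : ∀ {N} → Series N
oneS α = if allZero α then 1 else 0

e : ∀ {N} → ℕ → Series N
e k α = if allBinary α ∧ (V.sum α ≡ᵇ k) then 1 else 0

eC : ∀ {N} → List ℕ → Series N
eC []      = oneS
eC (i ∷ I) = e i ⊛ eC I

colorings : (n N : ℕ) → List (Vec (Fin N) n)
colorings zero    N = [ [] ]
colorings (suc n) N = concatMap (λ c → map (c ∷_) (colorings n N)) (allFin N)

finEq : ∀ {N} → Fin N → Fin N → Bool
finEq a b = toℕ a ≡ᵇ toℕ b

vecEq : ∀ {N} → Vec ℕ N → Vec ℕ N → Bool
vecEq []      []      = true
vecEq (a ∷ α) (b ∷ β) = (a ≡ᵇ b) ∧ vecEq α β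

proper : ∀ {n N} → (Fin n → Fin n → Bool) → Vec (Fin N) n → Bool
proper {n} adj κ =
  and (map (λ i → and (map (λ j → not (adj i j) ∨ not (finEq (lookup κ i) (lookup κ j)))
                           (allFin n)))
           (allFin n))

-- multiplicity vector of a coloring: the monomial ∏_v x_{κ(v)}
colorCount : ∀ {n N} → Vec (Fin N) n → Vec ℕ N
colorCount {n} {N} κ = tabulate (λ c → countᵇ (finEq c) κ)

X : ∀ {N} → (n : ℕ) → (Fin n → Fin n → Bool) → Series N
X {N} n adj α = length (filterᵇ (λ κ → proper adj κ ∧ vecEq (colorCount κ) α) (colorings n N))

pathAdj : (l : ℕ) → Fin l → Fin l → Bool
pathAdj l i j = (suc (toℕ i) ≡ᵇ toℕ j) ∨ (suc (toℕ j) ≡ᵇ toℕ i)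

-- cycle C_m : path edges plus the edge {0,m-1}
-- (for m = 2 this is the single edge {0,1})
cycleAdj : (m : ℕ) → Fin m → Fin m → Bool
cycleAdj m i j = pathAdj m i j
               ∨ ((toℕ i ≡ᵇ 0) ∧ (suc (toℕ j) ≡ᵇ m))
               ∨ ((toℕ j ≡ᵇ 0) ∧ (suc (toℕ i) ≡ᵇ m))

compositions : ℕ → List (List ℕ)
compositions zero    = [ [] ]
compositions (suc n) = map (1 ∷_) (compositions n) ++ concatMap bump (compositions n)
  where
  bump : List ℕ → List (List ℕ)
  bump []      = []
  bump (i ∷ I) = [ suc i ∷ I ]

-- first part (0 for the empty composition; never used there)
firstPart : List ℕ → ℕ
firstPart []      = 0
firstPart (i ∷ I) = i

w : List ℕ → ℕ
w []      = 1
w (i ∷ I) = i * product (map (λ j → j ∸ 1) I)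

partialSums : List ℕ → List ℕ
partialSums = go 0
  where
  go : ℕ → List ℕ → List ℕ
  go acc []      = [ acc ]
  go acc (i ∷ I) = acc ∷ go (acc + i) I

-- σ⁺_I(c) = min { partial sums ≥ c }  (the total |I| is one of them and is ≥ c
-- whenever c ≤ |I|, so using it as the initial value of the min is harmless)
σ⁺ : List ℕ → ℕ → ℕ
σ⁺ I c = foldr (λ p r → if c ≤ᵇ p then p ⊓ r else r) (sum I) (partialSums I)

Θ⁺ : List ℕ → ℕ → ℕ
Θ⁺ I c = σ⁺ I c ∸ c

XPC : ∀ {N} → ℕ → ℕ → Series N
XPC l m = X l (pathAdj l) ⊛ X m (cycleAdj m)

middleSum : ∀ {N} → ℕ → ℕ → Series N
middleSum l m =
  sumS (concatMap (λ I → map (λ J → (firstPart J * w (I ++ J)) · eC (I ++ J))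
                             (compositions m))
                  (compositions l))

rightSum : ∀ {N} → ℕ → ℕ → Series N
rightSum l m =
  sumS (map (λ K → ((Θ⁺ K (suc l) + 1) * w K) · eC K)
            (filterᵇ (λ K → Θ⁺ K l ≡ᵇ 0) (compositions (l + m))))

{-# OPTIONS --safe #-}
-- Work with generating functions in an extra variable t over the ring of symmetric
-- functions: E = Σ e_k t^k, S = Σ_l X_{P_l} t^l and C = Σ_m X_{C_m} t^m.  Proper colourings of a path
-- are Smirnov words (no two equal adjacent letters); splitting off the first letter c gives
-- S = (1 + x_c t) S_c, while E = (1 + x_c t) E_c, where E_c omits the variable x_c.  Moving the
-- factor 1 + x_c t from S to E yields E S = E + (t d/dt E) S.  On the other side, splitting a composition
-- at its first part expresses Σ_I w_I e_I t^{|I|} and Σ_J (j₁ - 1) w_J e_J t^{|J|} through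
-- T = Σ_I ∏_{i ∈ I} (i - 1) e_I t^{|I|}, and e_k + (k - 1) e_k = k e_k shows that E T solves the same
-- equation as S.  Since E has constant term 1 the solution is unique, so X_{P_l} = Σ_{I ⊨ l} w_I e_I.
-- Cutting a cyclic word at its first and last letter likewise gives E C = (t² d²/dt² E) S, whence
-- X_{C_m} = Σ_{J ⊨ m} (j₁ - 1) w_J e_J.  Multiplying, w_I (j₁ - 1) w_J = j₁ w_{IJ} gives the middle sum,
-- and the right sum is the same sum: Θ⁺_K(l) = 0 exactly when K = IJ with I ⊨ l, and then
-- Θ⁺_K(l + 1) + 1 = j₁.  Symmetric functions are handled through their coefficients: power series in
-- N variables form a commutative semiring because they embed into power series in one variable with
-- coefficients in N - 1 variables.
module Submission where

open import Defs
open import Data.Nat using (ℕ; _≤_)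
open import Data.Vec using (Vec)
open import Data.Product using (_×_)
open import Relation.Binary.PropositionalEquality using (_≡_)

open import Algebra.Bundles using (CommutativeSemiring)
import Algebra.Definitions
open import Algebra.Structures using (IsCommutativeSemiring; IsCommutativeMonoid)
open import Algebra.Structures.Biased using (IsCommutativeSemiringˡ; IsCommutativeMonoidˡ)
open import Data.Bool using (Bool; true; false; not; _∧_; _∨_; if_then_else_; T)
open import Data.Fin using (Fin; zero; suc)
open import Data.List using (List; []; _∷_; [_]; _++_; map; concatMap; foldr; applyUpTo)
import Data.List.Properties as List
open import Data.List.Relation.Unary.All as All using (All; []; _∷_)
open import Data.Nat using (zero; suc; _∸_; _<_; z≤n; s≤s)
open import Data.Nat.Induction using (<-rec)
open import Data.Nat.Properties using (≤-refl; m≤n⇒m≤1+n; +-*-commutativeSemiring)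
open import Data.Product using (_,_)
open import Function using (_∘_)
open import Relation.Binary.PropositionalEquality using (cong)
import Relation.Binary.PropositionalEquality as ≡

-- Power series in t over a commutative semiring

module FormalPowerSeries {c ℓ} (R : CommutativeSemiring c ℓ) where

  open CommutativeSemiring R
  open Algebra.Definitions _≈_ using (RightCancellative)
  open import Algebra.Properties.CommutativeSemigroup +-commutativeSemigroup
    using () renaming (interchange to +-interchange)
  open import Relation.Binary.Reasoning.Setoid setoid

  PowerSeries : Set c
  PowerSeries = ℕ → Carrier

  infix  4 _≋_
  infixl 6 _⊞_
  infixl 7 _⊠_
  infixr 8 t·_

  _≋_ : PowerSeries → PowerSeries → Set ℓ
  f ≋ g = ∀ n → f n ≈ g n

  _⊞_ _⊠_ : PowerSeries → PowerSeries → PowerSeries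
  (f ⊞ g) n = f n + g n
  (f ⊠ g) zero    = f 0 * g 0
  (f ⊠ g) (suc n) = f 0 * g (suc n) + ((f ∘ suc) ⊠ g) n

  𝟘 𝟙 : PowerSeries
  𝟘 _       = 0#
  𝟙 zero    = 1#
  𝟙 (suc _) = 0#

  const : Carrier → PowerSeries
  const a zero    = a
  const a (suc _) = 0#

  t·_ : PowerSeries → PowerSeries
  (t· f) zero    = 0#
  (t· f) (suc n) = f n

  ⊠-cong : ∀ {f f′ g g′} → f ≋ f′ → g ≋ g′ → f ⊠ g ≋ f′ ⊠ g′
  ⊠-cong f≋ g≋ zero    = *-cong (f≋ 0) (g≋ 0)
  ⊠-cong f≋ g≋ (suc n) = +-cong (*-cong (f≋ 0) (g≋ (suc n))) (⊠-cong (f≋ ∘ suc) g≋ n)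

  ⊠-zeroˡ : ∀ g → 𝟘 ⊠ g ≋ 𝟘
  ⊠-zeroˡ g zero    = zeroˡ (g 0)
  ⊠-zeroˡ g (suc n) = trans (+-cong (zeroˡ _) (⊠-zeroˡ g n)) (+-identityˡ 0#)

  ⊠-identityˡ : ∀ g → 𝟙 ⊠ g ≋ g
  ⊠-identityˡ g zero    = *-identityˡ (g 0)
  ⊠-identityˡ g (suc n) = trans (+-cong (*-identityˡ _) (⊠-zeroˡ g n)) (+-identityʳ _)

  ⊠-distribʳ : ∀ f g h → (g ⊞ h) ⊠ f ≋ g ⊠ f ⊞ h ⊠ f
  ⊠-distribʳ f g h zero    = distribʳ (f 0) (g 0) (h 0)
  ⊠-distribʳ f g h (suc n) = begin
    (g 0 + h 0) * f (suc n) + ((g ∘ suc ⊞ h ∘ suc) ⊠ f) n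
      ≈⟨ +-cong (distribʳ _ _ _) (⊠-distribʳ f (g ∘ suc) (h ∘ suc) n) ⟩
    (g 0 * f (suc n) + h 0 * f (suc n)) + (((g ∘ suc) ⊠ f) n + ((h ∘ suc) ⊠ f) n)
      ≈⟨ +-interchange _ _ _ _ ⟩
    (g ⊠ f) (suc n) + (h ⊠ f) (suc n) ∎

  ⊠-scaleˡ : ∀ a f g n → ((λ k → a * f k) ⊠ g) n ≈ a * (f ⊠ g) n
  ⊠-scaleˡ a f g zero    = *-assoc a (f 0) (g 0)
  ⊠-scaleˡ a f g (suc n) =
    trans (+-cong (*-assoc _ _ _) (⊠-scaleˡ a (f ∘ suc) g n)) (sym (distribˡ _ _ _))

  const-⊠ : ∀ a g n → (const a ⊠ g) n ≈ a * g n
  const-⊠ a g zero    = refl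
  const-⊠ a g (suc n) = trans (+-congˡ (⊠-zeroˡ g n)) (+-identityʳ _)

  ⊠-assoc : ∀ f g h → (f ⊠ g) ⊠ h ≋ f ⊠ (g ⊠ h)
  ⊠-assoc f g h zero    = *-assoc (f 0) (g 0) (h 0)
  ⊠-assoc f g h (suc n) = begin
    (f 0 * g 0) * h (suc n) + (((λ k → f 0 * g (suc k)) ⊞ (f ∘ suc) ⊠ g) ⊠ h) n
      ≈⟨ +-congˡ (⊠-distribʳ h _ _ n) ⟩
    (f 0 * g 0) * h (suc n) + (((λ k → f 0 * g (suc k)) ⊠ h) n + (((f ∘ suc) ⊠ g) ⊠ h) n)
      ≈⟨ +-congˡ (+-cong (⊠-scaleˡ (f 0) (g ∘ suc) h n) (⊠-assoc (f ∘ suc) g h n)) ⟩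
    (f 0 * g 0) * h (suc n) + (f 0 * ((g ∘ suc) ⊠ h) n + ((f ∘ suc) ⊠ (g ⊠ h)) n)
      ≈⟨ sym (+-assoc _ _ _) ⟩
    ((f 0 * g 0) * h (suc n) + f 0 * ((g ∘ suc) ⊠ h) n) + ((f ∘ suc) ⊠ (g ⊠ h)) n
      ≈⟨ +-congʳ (trans (+-congʳ (*-assoc _ _ _)) (sym (distribˡ _ _ _))) ⟩
    (f ⊠ (g ⊠ h)) (suc n) ∎

  ⊠-snoc : ∀ f g n → (f ⊠ g) (suc n) ≈ (f ⊠ (g ∘ suc)) n + f (suc n) * g 0
  ⊠-snoc f g zero    = refl
  ⊠-snoc f g (suc n) = begin
    f 0 * g (suc (suc n)) + ((f ∘ suc) ⊠ g) (suc n)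
      ≈⟨ +-congˡ (⊠-snoc (f ∘ suc) g n) ⟩
    f 0 * g (suc (suc n)) + (((f ∘ suc) ⊠ (g ∘ suc)) n + f (suc (suc n)) * g 0)
      ≈⟨ sym (+-assoc _ _ _) ⟩
    (f ⊠ (g ∘ suc)) (suc n) + f (suc (suc n)) * g 0 ∎

  ⊠-comm : ∀ f g → f ⊠ g ≋ g ⊠ f
  ⊠-comm f g zero    = *-comm (f 0) (g 0)
  ⊠-comm f g (suc n) = begin
    f 0 * g (suc n) + ((f ∘ suc) ⊠ g) n   ≈⟨ +-cong (*-comm _ _) (⊠-comm (f ∘ suc) g n) ⟩
    g (suc n) * f 0 + (g ⊠ (f ∘ suc)) n   ≈⟨ +-comm _ _ ⟩
    (g ⊠ (f ∘ suc)) n + g (suc n) * f 0   ≈⟨ sym (⊠-snoc g f n) ⟩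
    (g ⊠ f) (suc n)                       ∎

  ⊞-⊠-isCommutativeSemiring : IsCommutativeSemiring _≋_ _⊞_ _⊠_ 𝟘 𝟙
  ⊞-⊠-isCommutativeSemiring = IsCommutativeSemiringˡ.isCommutativeSemiring record
    { +-isCommutativeMonoid = commutativeMonoid (λ p q n → +-cong (p n) (q n))
        (λ f g h n → +-assoc _ _ _) (λ f n → +-identityˡ _) (λ f g n → +-comm _ _)
    ; *-isCommutativeMonoid = commutativeMonoid ⊠-cong ⊠-assoc ⊠-identityˡ ⊠-comm
    ; distribʳ              = ⊠-distribʳ
    ; zeroˡ                 = ⊠-zeroˡ
    }
    where
    commutativeMonoid : ∀ {_∙_ ε} → (∀ {f f′ g g′} → f ≋ f′ → g ≋ g′ → (f ∙ g) ≋ (f′ ∙ g′)) →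
      (∀ f g h → ((f ∙ g) ∙ h) ≋ (f ∙ (g ∙ h))) → (∀ f → (ε ∙ f) ≋ f) → (∀ f g → (f ∙ g) ≋ (g ∙ f)) →
      IsCommutativeMonoid _≋_ _∙_ ε
    commutativeMonoid {_∙_} {ε} ∙-cong ∙-assoc ∙-identityˡ ∙-comm = record
      { isMonoid = record
        { isSemigroup = record
          { isMagma = record
            { isEquivalence = record { refl = λ n → refl ; sym = λ p n → sym (p n) ; trans = λ p q n → trans (p n) (q n) }
            ; ∙-cong = ∙-cong }
          ; assoc = ∙-assoc }
        ; identity = ∙-identityˡ , λ f n → trans (∙-comm f ε n) (∙-identityˡ f n) }
      ; comm = ∙-comm }

  powerSeriesSemiring : CommutativeSemiring c ℓ
  powerSeriesSemiring = record { isCommutativeSemiring = ⊞-⊠-isCommutativeSemiring }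

  t·-⊠ : ∀ f g → (t· f) ⊠ g ≋ t· (f ⊠ g)
  t·-⊠ f g zero    = zeroˡ (g 0)
  t·-⊠ f g (suc n) = trans (+-congʳ (zeroˡ _)) (+-identityˡ _)

  ⊠-as-sum : ∀ f g n → foldr _+_ 0# (applyUpTo (λ k → f k * g (n ∸ k)) (suc n)) ≈ (f ⊠ g) n
  ⊠-as-sum f g zero    = +-identityʳ _
  ⊠-as-sum f g (suc n) = +-congˡ (⊠-as-sum (f ∘ suc) g n)

  ⊠-congʳ-upTo : ∀ f {g h} n → (∀ {j} → j ≤ n → g j ≈ h j) → (f ⊠ g) n ≈ (f ⊠ h) n
  ⊠-congʳ-upTo f zero    g≈h = *-congˡ (g≈h z≤n)
  ⊠-congʳ-upTo f (suc n) g≈h =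
    +-cong (*-congˡ (g≈h ≤-refl)) (⊠-congʳ-upTo (f ∘ suc) n (g≈h ∘ m≤n⇒m≤1+n))

  module _ (+-cancelʳ : RightCancellative _+_) where

    ⊞-cancelʳ : ∀ z x y → x ⊞ z ≋ y ⊞ z → x ≋ y
    ⊞-cancelʳ z x y x+z≋y+z n = +-cancelʳ (z n) (x n) (y n) (x+z≋y+z n)

    -- In degree n the unknown enters the left side as x n plus terms of lower degree, and the right
    -- side only through terms of lower degree.
    ⊠-equation-unique : ∀ {a b d x y} → a 0 ≈ 1# → b 0 ≈ 0# →
      a ⊠ x ≋ d ⊞ b ⊠ x → a ⊠ y ≋ d ⊞ b ⊠ y → x ≋ y
    ⊠-equation-unique {a} {b} {d} {x} {y} a₀≈1 b₀≈0 eqx eqy =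
      <-rec (λ n → x n ≈ y n) agree
      where
      a₀-unit : ∀ v → a 0 * v ≈ v
      a₀-unit v = trans (*-congʳ a₀≈1) (*-identityˡ v)
      b₀-null : ∀ v → b 0 * v ≈ 0#
      b₀-null v = trans (*-congʳ b₀≈0) (zeroˡ v)
      b-shift : ∀ z n → (b ⊠ z) (suc n) ≈ (b ∘ suc ⊠ z) n
      b-shift z n = trans (+-congʳ (b₀-null _)) (+-identityˡ _)
      agree : ∀ n → (∀ {j} → j < n → x j ≈ y j) → x n ≈ y n
      agree zero _ = begin
        x 0                ≈⟨ sym (a₀-unit (x 0)) ⟩
        (a ⊠ x) 0          ≈⟨ eqx 0 ⟩
        d 0 + (b ⊠ x) 0    ≈⟨ +-congˡ (trans (b₀-null (x 0)) (sym (b₀-null (y 0)))) ⟩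
        d 0 + (b ⊠ y) 0    ≈⟨ sym (eqy 0) ⟩
        (a ⊠ y) 0          ≈⟨ a₀-unit (y 0) ⟩
        y 0                ∎
      agree (suc n) below = +-cancelʳ ((a ∘ suc ⊠ y) n) (x (suc n)) (y (suc n)) (begin
        x (suc n) + (a ∘ suc ⊠ y) n  ≈⟨ +-congˡ (sym (⊠-congʳ-upTo (a ∘ suc) n (below ∘ s≤s))) ⟩
        x (suc n) + (a ∘ suc ⊠ x) n  ≈⟨ +-congʳ (sym (a₀-unit _)) ⟩
        (a ⊠ x) (suc n)              ≈⟨ eqx (suc n) ⟩
        d (suc n) + (b ⊠ x) (suc n)  ≈⟨ +-congˡ (b-shift x n) ⟩
        d (suc n) + (b ∘ suc ⊠ x) n  ≈⟨ +-congˡ (⊠-congʳ-upTo (b ∘ suc) n (below ∘ s≤s)) ⟩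
        d (suc n) + (b ∘ suc ⊠ y) n  ≈⟨ +-congˡ (sym (b-shift y n)) ⟩
        d (suc n) + (b ⊠ y) (suc n)  ≈⟨ sym (eqy (suc n)) ⟩
        (a ⊠ y) (suc n)              ≈⟨ +-congʳ (a₀-unit _) ⟩
        y (suc n) + (a ∘ suc ⊠ y) n  ∎)

    ⊠-cancelˡ : ∀ {a x y} → a 0 ≈ 1# → a ⊠ x ≋ a ⊠ y → x ≋ y
    ⊠-cancelˡ {a} {x} {y} a₀≈1 ax≋ay = ⊠-equation-unique {b = 𝟘} a₀≈1 refl
      (λ n → sym (+-identityʳ-via (⊠-zeroˡ x n)))
      (λ n → trans (sym (ax≋ay n)) (sym (+-identityʳ-via (⊠-zeroˡ y n))))
      where
      +-identityʳ-via : ∀ {u v} → v ≈ 0# → u + v ≈ u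
      +-identityʳ-via v≈0 = trans (+-congˡ v≈0) (+-identityʳ _)

module TransferAlongEmbedding {c ℓ} (T : CommutativeSemiring c ℓ) where

  open CommutativeSemiring T hiding (isCommutativeSemiring)

  module _ {a ℓ′} {A : Set a} (_≈ᴬ_ : A → A → Set ℓ′) (_+ᴬ_ _*ᴬ_ : A → A → A) (0ᴬ 1ᴬ : A)
    (⟦_⟧ : A → Carrier)
    (⟦⟧-cong : ∀ {x y} → x ≈ᴬ y → ⟦ x ⟧ ≈ ⟦ y ⟧)
    (⟦⟧-injective : ∀ {x y} → ⟦ x ⟧ ≈ ⟦ y ⟧ → x ≈ᴬ y)
    (+-homo : ∀ x y → ⟦ x +ᴬ y ⟧ ≈ ⟦ x ⟧ + ⟦ y ⟧)
    (*-homo : ∀ x y → ⟦ x *ᴬ y ⟧ ≈ ⟦ x ⟧ * ⟦ y ⟧)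
    (0-homo : ⟦ 0ᴬ ⟧ ≈ 0#)
    (1-homo : ⟦ 1ᴬ ⟧ ≈ 1#)
    where

    private
      reflect : ∀ {x y u v} → ⟦ x ⟧ ≈ u → ⟦ y ⟧ ≈ v → u ≈ v → x ≈ᴬ y
      reflect ⟦x⟧≈u ⟦y⟧≈v u≈v = ⟦⟧-injective (trans ⟦x⟧≈u (trans u≈v (sym ⟦y⟧≈v)))

      isCommutativeMonoid : ∀ {_∙ᴬ_ εᴬ _∙_ ε} → IsCommutativeMonoid _≈_ _∙_ ε →
        (∀ x y → ⟦ x ∙ᴬ y ⟧ ≈ ⟦ x ⟧ ∙ ⟦ y ⟧) → ⟦ εᴬ ⟧ ≈ ε →
        IsCommutativeMonoid _≈ᴬ_ _∙ᴬ_ εᴬ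
      isCommutativeMonoid {_∙ᴬ_} {εᴬ} {_∙_} {ε} M homo ε-homo = IsCommutativeMonoidˡ.isCommutativeMonoid record
        { isSemigroup = record
          { isMagma = record
            { isEquivalence = record
              { refl  = ⟦⟧-injective refl
              ; sym   = λ x≈y → ⟦⟧-injective (sym (⟦⟧-cong x≈y))
              ; trans = λ x≈y y≈z → ⟦⟧-injective (trans (⟦⟧-cong x≈y) (⟦⟧-cong y≈z)) }
            ; ∙-cong = λ x≈y u≈v → reflect (homo _ _) (homo _ _) (M.∙-cong (⟦⟧-cong x≈y) (⟦⟧-cong u≈v)) }
          ; assoc = λ x y z → reflect (trans (homo _ z) (M.∙-congʳ (homo x y)))
                                      (trans (homo x _) (M.∙-congˡ (homo y z))) (M.assoc _ _ _) }
        ; identityˡ = λ x → reflect (trans (homo εᴬ x) (M.∙-congʳ ε-homo)) refl (M.identityˡ _)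
        ; comm      = λ x y → reflect (homo x y) (homo y x) (M.comm _ _)
        }
        where module M = IsCommutativeMonoid M

    isCommutativeSemiring : IsCommutativeSemiring _≈ᴬ_ _+ᴬ_ _*ᴬ_ 0ᴬ 1ᴬ
    isCommutativeSemiring = IsCommutativeSemiringˡ.isCommutativeSemiring record
      { +-isCommutativeMonoid = isCommutativeMonoid +-isCommutativeMonoid +-homo 0-homo
      ; *-isCommutativeMonoid = isCommutativeMonoid *-isCommutativeMonoid *-homo 1-homo
      ; distribʳ = λ x y z → reflect (trans (*-homo _ x) (*-congʳ (+-homo y z)))
                                     (trans (+-homo _ _) (+-cong (*-homo y x) (*-homo z x))) (distribʳ _ _ _)
      ; zeroˡ    = λ x → reflect (trans (*-homo 0ᴬ x) (*-congʳ 0-homo)) 0-homo (zeroˡ _)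
      }

module Sums {c ℓ} (R : CommutativeSemiring c ℓ) where

  open CommutativeSemiring R hiding (zero)
  open import Algebra.Properties.Semiring.Sum semiring public
  open import Relation.Binary.Reasoning.Setoid setoid

  Σˡ : List Carrier → Carrier
  Σˡ = foldr _+_ 0#

  Σˡ-++ : ∀ xs ys → Σˡ (xs ++ ys) ≈ Σˡ xs + Σˡ ys
  Σˡ-++ []       ys = sym (+-identityˡ _)
  Σˡ-++ (x ∷ xs) ys = trans (+-congˡ (Σˡ-++ xs ys)) (sym (+-assoc _ _ _))

  Σˡ-cong : ∀ {A : Set} {f g : A → Carrier} → (∀ x → f x ≈ g x) → ∀ xs → Σˡ (map f xs) ≈ Σˡ (map g xs)
  Σˡ-cong f≈g []       = refl
  Σˡ-cong f≈g (x ∷ xs) = +-cong (f≈g x) (Σˡ-cong f≈g xs)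

  Σˡ-cong-local : ∀ {A : Set} {f g : A → Carrier} {xs} → All (λ x → f x ≈ g x) xs → Σˡ (map f xs) ≈ Σˡ (map g xs)
  Σˡ-cong-local []           = refl
  Σˡ-cong-local (fx≈gx ∷ ps) = +-cong fx≈gx (Σˡ-cong-local ps)

  Σˡ-zero : ∀ {A : Set} (xs : List A) → Σˡ (map (λ _ → 0#) xs) ≈ 0#
  Σˡ-zero []       = refl
  Σˡ-zero (x ∷ xs) = trans (+-identityˡ _) (Σˡ-zero xs)

  Σˡ-concatMap : ∀ {A : Set} (g : A → List Carrier) xs → Σˡ (concatMap g xs) ≈ Σˡ (map (Σˡ ∘ g) xs)
  Σˡ-concatMap g []       = refl
  Σˡ-concatMap g (x ∷ xs) = trans (Σˡ-++ (g x) (concatMap g xs)) (+-congˡ (Σˡ-concatMap g xs))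

  Σˡ-map-concatMap : ∀ {A B : Set} (f : B → Carrier) (g : A → List B) xs →
    Σˡ (map f (concatMap g xs)) ≈ Σˡ (map (λ x → Σˡ (map f (g x))) xs)
  Σˡ-map-concatMap f g xs = trans (reflexive (cong Σˡ (List.map-concatMap f g xs))) (Σˡ-concatMap (map f ∘ g) xs)

  *-distribˡ-Σˡ : ∀ {A : Set} a (f : A → Carrier) xs → a * Σˡ (map f xs) ≈ Σˡ (map (λ x → a * f x) xs)
  *-distribˡ-Σˡ a f []       = zeroʳ a
  *-distribˡ-Σˡ a f (x ∷ xs) = trans (distribˡ _ _ _) (+-congˡ (*-distribˡ-Σˡ a f xs))

  *-distribʳ-Σˡ : ∀ {A : Set} a (f : A → Carrier) xs → Σˡ (map f xs) * a ≈ Σˡ (map (λ x → f x * a) xs)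
  *-distribʳ-Σˡ a f []       = zeroˡ a
  *-distribʳ-Σˡ a f (x ∷ xs) = trans (distribʳ _ _ _) (+-congˡ (*-distribʳ-Σˡ a f xs))

  when : Bool → Carrier → Carrier
  when b x = if b then x else 0#

  when-cong : ∀ b {x y} → x ≈ y → when b x ≈ when b y
  when-cong true  x≈y = x≈y
  when-cong false _   = refl

  *-when : ∀ b x y → x * when b y ≈ when b (x * y)
  *-when true  x y = refl
  *-when false x y = zeroʳ x

  when-* : ∀ b x y → when b x * y ≈ when b (x * y)
  when-* true  x y = refl
  when-* false x y = zeroˡ y

  when-sum : ∀ b {n} (f : Fin n → Carrier) → when b (sum f) ≈ ∑[ i < n ] when b (f i)
  when-sum true  f = refl
  when-sum false {n} f = sym (sum-replicate-zero n)

  ∑-pick : ∀ {n} (c : Fin n) (f : Fin n → Carrier) → sum f ≈ f c + ∑[ d < n ] when (not (finEq d c)) (f d)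
  ∑-pick zero    f = +-congˡ (sym (+-identityˡ _))
  ∑-pick (suc c) f = begin
    f zero + sum (f ∘ suc)                                               ≈⟨ +-congˡ (∑-pick c (f ∘ suc)) ⟩
    f zero + (f (suc c) + ∑[ d < _ ] when (not (finEq d c)) (f (suc d))) ≈⟨ x∙yz≈y∙xz _ _ _ ⟩
    f (suc c) + (f zero + ∑[ d < _ ] when (not (finEq d c)) (f (suc d))) ∎
    where open import Algebra.Properties.CommutativeSemigroup +-commutativeSemigroup using (x∙yz≈y∙xz)

  when-not-cong : ∀ b {x y} → (b ≡ false → x ≈ y) → when (not b) x ≈ when (not b) y
  when-not-cong true  _   = refl
  when-not-cong false x≈y = x≈y ≡.refl

  *-distribˡ-∑-when : ∀ {n} x (bs : Fin n → Bool) (f : Fin n → Carrier) →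
    x * ∑[ i < n ] when (bs i) (f i) ≈ ∑[ i < n ] when (bs i) (x * f i)
  *-distribˡ-∑-when x bs f = trans (*-distribˡ-sum x (λ i → when (bs i) (f i))) (sum-cong-≋ λ i → *-when (bs i) x (f i))

  *-distribʳ-∑-when : ∀ {n} x (bs : Fin n → Bool) (f : Fin n → Carrier) →
    (∑[ i < n ] when (bs i) (f i)) * x ≈ ∑[ i < n ] when (bs i) (f i * x)
  *-distribʳ-∑-when x bs f = trans (*-distribʳ-sum x (λ i → when (bs i) (f i))) (sum-cong-≋ λ i → when-* (bs i) (f i) x)

-- Imported only now: their arithmetic operators would clash with the semiring operations opened above.
open import Level using (0ℓ)
open import Data.Bool.Properties using (∧-zeroʳ; ∧-assoc; if-eta; if-swap-then)
open import Data.Bool.ListAction using (and)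
open import Data.Empty using (⊥-elim)
open import Data.Fin using (toℕ; fromℕ)
open import Data.Fin.Properties using (toℕ-fromℕ)
open import Data.Fin.Subset using (Subset; ⊥; inside; outside)
open import Data.List using (upTo; allFin; filterᵇ; length; drop)
import Data.List.Relation.Unary.All.Properties as Allₚ
open import Data.Maybe using (Maybe; just; nothing)
open import Data.Nat using (pred; _+_; _*_; _⊓_; _≡ᵇ_; _≤ᵇ_)
import Data.Nat.ListAction as ℕ
open import Data.Nat.ListAction.Properties using (product-++)
open import Data.Nat.Properties
  using (+-identityʳ; +-comm; +-assoc; +-cancelʳ-≡; *-zeroʳ; *-comm; *-assoc; *-distribˡ-+; *-commutativeSemigroup;
         +-distribˡ-⊓; m≤m+n; ⊓-glb; m≤n⇒m⊓n≡m; ≡⇒≡ᵇ)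
open import Data.Nat.Solver using (module +-*-Solver)
open import Data.Product using (∃₂; proj₁; proj₂)
open import Data.Sum using (_⊎_; inj₁; inj₂)
open import Data.Unit using (tt)
open import Data.Vec using ([]; _∷_; lookup; tabulate; countᵇ; zipWith; last; _[_]%=_; _[_]≔_)
open import Data.Vec.Properties using (lookup-replicate)
open import Function using (_$_; id)
open import Relation.Nullary.Decidable using (T?)
open ≡ using (_≗_; refl; cong₂)

module ℕΣ = Sums +-*-commutativeSemiring

-- Power series in N variables

seriesSemiringFrom : ∀ {N} → IsCommutativeSemiring (_≗_ {A = Vec ℕ N}) _⊕_ _⊛_ zeroS oneS → CommutativeSemiring 0ℓ 0ℓ
seriesSemiringFrom isCS = record { isCommutativeSemiring = isCS }

slice : ∀ {N} → Series (suc N) → ℕ → Series N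
slice f b α = f (b ∷ α)

module _ {N} (isCS : IsCommutativeSemiring (_≗_ {A = Vec ℕ N}) _⊕_ _⊛_ zeroS oneS) where

  open FormalPowerSeries (seriesSemiringFrom isCS)
  open ≡.≡-Reasoning

  sumS-at : (fs : List (Series N)) (α : Vec ℕ N) → sumS fs α ≡ ℕΣ.Σˡ (map (_$ α) fs)
  sumS-at []       α = refl
  sumS-at (f ∷ fs) α = cong (f α +_) (sumS-at fs α)

  ⊛-slice : ∀ (f g : Series (suc N)) a α → (f ⊛ g) (a ∷ α) ≡ (slice f ⊠ slice g) a α
  ⊛-slice f g a α = begin
    (f ⊛ g) (a ∷ α)
      ≡⟨ ℕΣ.Σˡ-map-concatMap _ (λ b → map (b ∷_) (below α)) (upTo (suc a)) ⟩
    ℕΣ.Σˡ (map (λ b → ℕΣ.Σˡ (map term (map (b ∷_) (below α)))) (upTo (suc a)))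
      ≡⟨ cong ℕΣ.Σˡ (List.map-cong (λ b → cong ℕΣ.Σˡ (≡.sym (List.map-∘ (below α)))) (upTo (suc a))) ⟩
    ℕΣ.Σˡ (map (λ b → (slice f b ⊛ slice g (a ∸ b)) α) (upTo (suc a)))
      ≡⟨ cong ℕΣ.Σˡ (List.map-applyUpTo id (λ b → (slice f b ⊛ slice g (a ∸ b)) α) (suc a)) ⟩
    ℕΣ.Σˡ (applyUpTo (λ b → (slice f b ⊛ slice g (a ∸ b)) α) (suc a))
      ≡⟨ cong ℕΣ.Σˡ (≡.sym (List.map-applyUpTo (λ b → slice f b ⊛ slice g (a ∸ b)) (_$ α) (suc a))) ⟩
    ℕΣ.Σˡ (map (_$ α) (applyUpTo (λ b → slice f b ⊛ slice g (a ∸ b)) (suc a)))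
      ≡⟨ ≡.sym (sumS-at (applyUpTo (λ b → slice f b ⊛ slice g (a ∸ b)) (suc a)) α) ⟩
    sumS (applyUpTo (λ b → slice f b ⊛ slice g (a ∸ b)) (suc a)) α
      ≡⟨ ⊠-as-sum (slice f) (slice g) a α ⟩
    (slice f ⊠ slice g) a α ∎
    where
    term : Vec ℕ (suc N) → ℕ
    term β = f β * g (zipWith _∸_ (a ∷ α) β)

  slice-isCommutativeSemiring : IsCommutativeSemiring (_≗_ {A = Vec ℕ (suc N)}) _⊕_ _⊛_ zeroS oneS
  slice-isCommutativeSemiring = TransferAlongEmbedding.isCommutativeSemiring powerSeriesSemiring
    _≗_ _⊕_ _⊛_ zeroS oneS slice
    (λ f≗g b α → f≗g (b ∷ α)) (λ { slices≋ (b ∷ α) → slices≋ b α })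
    (λ f g b α → refl) (λ f g b α → ⊛-slice f g b α) (λ b α → refl) slice-oneS
    where
    slice-oneS : slice oneS ≋ 𝟙
    slice-oneS zero    α = refl
    slice-oneS (suc b) α = refl

⊕-⊛-isCommutativeSemiring : ∀ N → IsCommutativeSemiring (_≗_ {A = Vec ℕ N}) _⊕_ _⊛_ zeroS oneS
⊕-⊛-isCommutativeSemiring zero    = TransferAlongEmbedding.isCommutativeSemiring +-*-commutativeSemiring
  _≗_ _⊕_ _⊛_ zeroS oneS (_$ [])
  (_$ []) (λ { f≡g [] → f≡g }) (λ f g → refl) (λ f g → +-identityʳ _) refl refl
⊕-⊛-isCommutativeSemiring (suc N) = slice-isCommutativeSemiring (⊕-⊛-isCommutativeSemiring N)

seriesSemiring : ℕ → CommutativeSemiring 0ℓ 0ℓ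
seriesSemiring N = seriesSemiringFrom (⊕-⊛-isCommutativeSemiring N)

x[_] : ∀ {N} → Fin N → Series N
x[ zero  ] (a ∷ α) = if a ≡ᵇ 1 then oneS α else 0
x[ suc c ] (a ∷ α) = if a ≡ᵇ 0 then x[ c ] α else 0

x[]-⊛ : ∀ {N} (c : Fin N) (f : Series N) α →
  (x[ c ] ⊛ f) α ≡ (if 1 ≤ᵇ lookup α c then f (α [ c ]%= pred) else 0)
x[]-⊛ {suc N} c f (a ∷ α) = ≡.trans (⊛-slice (⊕-⊛-isCommutativeSemiring N) x[ c ] f a α) (first-variable c a)
  where
  open FormalPowerSeries (seriesSemiring N)
  first-variable : ∀ c a → (slice x[ c ] ⊠ slice f) a α ≡ (if 1 ≤ᵇ lookup (a ∷ α) c then f ((a ∷ α) [ c ]%= pred) else 0)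
  first-variable zero a = ≡.trans (⊠-cong slice-x₀ (λ _ _ → refl) a α) (≡.trans (t·-⊠ 𝟙 (slice f) a α) (shifted a))
    where
    slice-x₀ : slice x[ zero ] ≋ t· 𝟙
    slice-x₀ zero          _ = refl
    slice-x₀ (suc zero)    _ = refl
    slice-x₀ (suc (suc _)) _ = refl
    shifted : ∀ a → (t· (𝟙 ⊠ slice f)) a α ≡ (if 1 ≤ᵇ a then f (pred a ∷ α) else 0)
    shifted zero    = refl
    shifted (suc a) = ⊠-identityˡ (slice f) a α
  first-variable (suc c) a = begin
    (slice x[ suc c ] ⊠ slice f) a α ≡⟨ ⊠-cong slice-x (λ _ _ → refl) a α ⟩
    (const x[ c ] ⊠ slice f) a α     ≡⟨ const-⊠ x[ c ] (slice f) a α ⟩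
    (x[ c ] ⊛ slice f a) α           ≡⟨ x[]-⊛ c (slice f a) α ⟩
    (if 1 ≤ᵇ lookup α c then f (a ∷ α [ c ]%= pred) else 0) ∎
    where
    open ≡.≡-Reasoning
    slice-x : slice x[ suc c ] ≋ const x[ c ]
    slice-x zero    _ = refl
    slice-x (suc _) _ = refl

⊛-scaleʳ : ∀ {N} n (f g : Series N) α → (f ⊛ (n · g)) α ≡ n * (f ⊛ g) α
⊛-scaleʳ n f g α =
  ≡.trans (ℕΣ.Σˡ-cong (λ β → x∙yz≈y∙xz (f β) n _) (below α)) (≡.sym (ℕΣ.*-distribˡ-Σˡ n _ (below α)))
  where
  open import Algebra.Properties.CommutativeSemigroup *-commutativeSemigroup using (x∙yz≈y∙xz)

scale-⊛-scale : ∀ {N} a b (f g : Series N) → (a · f) ⊛ (b · g) ≗ (a * b) · (f ⊛ g)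
scale-⊛-scale {N} a b f g α = begin
  ((a · f) ⊛ (b · g)) α   ≡⟨ ⊛-scaleʳ b (a · f) g α ⟩
  b * ((a · f) ⊛ g) α     ≡⟨ cong (b *_) (𝕊.*-comm (a · f) g α) ⟩
  b * (g ⊛ (a · f)) α     ≡⟨ cong (b *_) (⊛-scaleʳ a g f α) ⟩
  b * (a * (g ⊛ f) α)     ≡⟨ cong (λ x → b * (a * x)) (𝕊.*-comm g f α) ⟩
  b * (a * (f ⊛ g) α)     ≡⟨ *-assoc b a _ ⟨
  (b * a) * (f ⊛ g) α     ≡⟨ cong (_* (f ⊛ g) α) (*-comm b a) ⟩
  (a * b) * (f ⊛ g) α     ∎
  where
  open ≡.≡-Reasoning
  module 𝕊 = CommutativeSemiring (seriesSemiring N)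

-- Elementary symmetric functions

-- e_k in the variables x_c with c ∉ U.
eOutside : ∀ {N} → Subset N → ℕ → Series N
eOutside []            k       []                 = if k ≡ᵇ 0 then 1 else 0
eOutside (_ ∷ U)       k       (zero ∷ α)         = eOutside U k α
eOutside (inside ∷ U)  k       (suc _ ∷ α)        = 0
eOutside (outside ∷ U) _       (suc (suc _) ∷ α)  = 0
eOutside (outside ∷ U) zero    (suc zero ∷ α)     = 0
eOutside (outside ∷ U) (suc k) (suc zero ∷ α)     = eOutside U k α

e≗eOutside⊥ : ∀ {N} k → e k ≗ eOutside {N} ⊥ k
e≗eOutside⊥ zero    []                 = refl
e≗eOutside⊥ (suc k) []                 = refl
e≗eOutside⊥ k       (zero ∷ α)         = e≗eOutside⊥ k α
e≗eOutside⊥ zero    (suc zero ∷ α)     = cong (λ b → if b then 1 else 0) (∧-zeroʳ (allBinary α))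
e≗eOutside⊥ (suc k) (suc zero ∷ α)     = e≗eOutside⊥ k α
e≗eOutside⊥ k       (suc (suc _) ∷ α)  = refl

eOutside-zero : ∀ {N} (U : Subset N) → eOutside U 0 ≗ oneS
eOutside-zero []            []          = refl
eOutside-zero (_ ∷ U)       (zero ∷ α)  = eOutside-zero U α
eOutside-zero (inside ∷ U)  (suc _ ∷ α) = refl
eOutside-zero (outside ∷ U) (suc zero ∷ α)    = refl
eOutside-zero (outside ∷ U) (suc (suc _) ∷ α) = refl

eOutside-split : ∀ {N} (U : Subset N) c → lookup U c ≡ outside → ∀ k α →
  eOutside U (suc k) α ≡
  eOutside (U [ c ]≔ inside) (suc k) α + (if 1 ≤ᵇ lookup α c then eOutside (U [ c ]≔ inside) k (α [ c ]%= pred) else 0)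
eOutside-split (outside ∷ U) zero refl k (zero ∷ α)         = ≡.sym (+-identityʳ _)
eOutside-split (outside ∷ U) zero refl k (suc zero ∷ α)     = refl
eOutside-split (outside ∷ U) zero refl k (suc (suc _) ∷ α)  = refl
eOutside-split (u ∷ U) (suc c) c∉U k (zero ∷ α)             = eOutside-split U c c∉U k α
eOutside-split (inside ∷ U) (suc c) c∉U k (suc a ∷ α)       = ≡.sym (if-eta (1 ≤ᵇ lookup α c))
eOutside-split (outside ∷ U) (suc c) c∉U k (suc (suc a) ∷ α) = ≡.sym (if-eta (1 ≤ᵇ lookup α c))
eOutside-split (outside ∷ U) (suc c) c∉U zero (suc zero ∷ α) = begin
  eOutside U 0 α                      ≡⟨ eOutside-zero U α ⟩
  oneS α                              ≡⟨ eOutside-zero (U [ c ]≔ inside) α ⟨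
  eOutside (U [ c ]≔ inside) 0 α      ≡⟨ +-identityʳ _ ⟨
  eOutside (U [ c ]≔ inside) 0 α + 0  ≡⟨ cong (eOutside (U [ c ]≔ inside) 0 α +_) (if-eta (1 ≤ᵇ lookup α c)) ⟨
  eOutside (U [ c ]≔ inside) 0 α + (if 1 ≤ᵇ lookup α c then 0 else 0) ∎
  where open ≡.≡-Reasoning
eOutside-split (outside ∷ U) (suc c) c∉U (suc k) (suc zero ∷ α) = eOutside-split U c c∉U k α

∑-zero : ∀ {n} (g : Fin n → ℕ) → (∀ i → g i ≡ 0) → ℕΣ.sum g ≡ 0
∑-zero {n} g g≡0 = ≡.trans (ℕΣ.sum-cong-≗ g≡0) (ℕΣ.sum-replicate-zero n)

private
  vanishes : ∀ b b′ → ℕΣ.when b (if b′ then 0 else 0) ≡ 0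
  vanishes b b′ = ≡.trans (cong (ℕΣ.when b) (if-eta b′)) (if-eta b)

eOutside-derivative : ∀ {N} (U : Subset N) k α →
  suc k * eOutside U (suc k) α ≡
  ℕΣ.sum λ c → ℕΣ.when (not (lookup U c)) (if 1 ≤ᵇ lookup α c then eOutside (U [ c ]≔ inside) k (α [ c ]%= pred) else 0)
eOutside-derivative []            k       []                 = *-zeroʳ (suc k)
eOutside-derivative (u ∷ U)       k       (zero ∷ α)         =
  ≡.trans (eOutside-derivative U k α) (cong₂ _+_ (≡.sym (if-eta (not u))) refl)
eOutside-derivative (inside ∷ U)  k       (suc a ∷ α)        =
  ≡.trans (*-zeroʳ (suc k)) (≡.sym (∑-zero _ λ c → vanishes (not (lookup U c)) (1 ≤ᵇ lookup α c)))
eOutside-derivative (outside ∷ U) k       (suc (suc a) ∷ α)  =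
  ≡.trans (*-zeroʳ (suc k)) (≡.sym (∑-zero _ λ c → vanishes (not (lookup U c)) (1 ≤ᵇ lookup α c)))
eOutside-derivative (outside ∷ U) zero    (suc zero ∷ α)     =
  cong (eOutside U 0 α +_) (≡.sym (∑-zero _ λ c → vanishes (not (lookup U c)) (1 ≤ᵇ lookup α c)))
eOutside-derivative (outside ∷ U) (suc k) (suc zero ∷ α)     = cong (eOutside U (suc k) α +_) (eOutside-derivative U k α)

lookup-⊥-insert : ∀ {N} (c d : Fin N) → lookup (⊥ [ c ]≔ inside) d ≡ finEq d c
lookup-⊥-insert zero    zero    = refl
lookup-⊥-insert zero    (suc d) = lookup-replicate d outside
lookup-⊥-insert (suc c) zero    = refl
lookup-⊥-insert (suc c) (suc d) = lookup-⊥-insert c d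

module GeneratingSeries (N : ℕ) where

  open FormalPowerSeries (seriesSemiring N) public
  module 𝕊 = CommutativeSemiring (seriesSemiring N)
  module 𝕋 = CommutativeSemiring powerSeriesSemiring
  module 𝕊Σ = Sums (seriesSemiring N)
  module 𝕋Σ = Sums powerSeriesSemiring
  open 𝕋Σ public using (sum; sum-syntax; when)

  Z : Fin N → PowerSeries
  Z c = t· const x[ c ]

  Z-⊠-zero : ∀ c F → (Z c ⊠ F) 0 ≗ zeroS
  Z-⊠-zero c F = 𝕊.zeroˡ (F 0)

  Z-⊠-suc : ∀ c F k → (Z c ⊠ F) (suc k) ≗ x[ c ] ⊛ F k
  Z-⊠-suc c F k = 𝕊.trans (t·-⊠ (const x[ c ]) F (suc k)) (const-⊠ x[ c ] F k)

  ∑-coeff : ∀ {n} (F : Fin n → PowerSeries) k → (∑[ c < n ] F c) k ≡ 𝕊Σ.sum (λ c → F c k)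
  ∑-coeff {zero}  F k = refl
  ∑-coeff {suc n} F k = cong (F zero k ⊕_) (∑-coeff (F ∘ suc) k)

  when-coeff : ∀ b F k → when b F k ≡ 𝕊Σ.when b (F k)
  when-coeff true  F k = refl
  when-coeff false F k = refl

  ∑-when-coeff : ∀ {n} (bs : Fin n → Bool) (F : Fin n → PowerSeries) k →
    (∑[ c < n ] when (bs c) (F c)) k 𝕊.≈ 𝕊Σ.sum (λ c → 𝕊Σ.when (bs c) (F c k))
  ∑-when-coeff bs F k = 𝕊.trans (𝕊.reflexive (∑-coeff (λ c → when (bs c) (F c)) k))
    (𝕊Σ.sum-cong-≋ λ c → 𝕊.reflexive (when-coeff (bs c) (F c) k))

  ∑-at : ∀ {n} (f : Fin n → Series N) α → 𝕊Σ.sum f α ≡ ℕΣ.sum (λ c → f c α)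
  ∑-at {zero}  f α = refl
  ∑-at {suc n} f α = cong (f zero α +_) (∑-at (f ∘ suc) α)

  when-at : ∀ b f α → 𝕊Σ.when b f α ≡ ℕΣ.when b (f α)
  when-at true  f α = refl
  when-at false f α = refl

  -- tD is the Euler operator t d/dt and t²D² is t² d²/dt².
  scaled : (ℕ → ℕ) → PowerSeries → PowerSeries
  scaled s F k = s k · F k

  tD t²D² : PowerSeries → PowerSeries
  tD   = scaled id
  t²D² = scaled (λ k → k * (k ∸ 1))

  E : PowerSeries
  E k = e k

  Eout : Subset N → PowerSeries
  Eout U k = eOutside U k

  E≋Eout⊥ : E ≋ Eout ⊥
  E≋Eout⊥ k = e≗eOutside⊥ k

  Eout-split : ∀ U c → lookup U c ≡ outside → Eout U ≋ (𝟙 ⊞ Z c) ⊠ Eout (U [ c ]≔ inside)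
  Eout-split U c c∉U k = 𝕊.trans (coefficient k)
    (𝕊.sym (𝕊.trans (⊠-distribʳ (Eout U′) 𝟙 (Z c) k) (𝕊.+-congʳ (⊠-identityˡ (Eout U′) k))))
    where
    U′ = U [ c ]≔ inside
    coefficient : ∀ k → Eout U k ≗ (Eout U′ ⊞ Z c ⊠ Eout U′) k
    coefficient zero α = ≡.trans (eOutside-zero U α) (≡.sym (≡.trans
      (cong₂ _+_ (eOutside-zero U′ α) (Z-⊠-zero c (Eout U′) α)) (+-identityʳ _)))
    coefficient (suc k) α = ≡.trans (eOutside-split U c c∉U k α)
      (cong (eOutside U′ (suc k) α +_) (≡.sym (≡.trans (Z-⊠-suc c (Eout U′) k α) (x[]-⊛ c (eOutside U′ k) α))))

  Eout-derivative : ∀ U → tD (Eout U) ≋ ∑[ c < N ] when (not (lookup U c)) (Z c ⊠ Eout (U [ c ]≔ inside))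
  Eout-derivative U = coefficient
    where
    summand : Fin N → PowerSeries
    summand c = when (not (lookup U c)) (Z c ⊠ Eout (U [ c ]≔ inside))
    summand-at : ∀ c k α → summand c k α ≡ ℕΣ.when (not (lookup U c)) ((Z c ⊠ Eout (U [ c ]≔ inside)) k α)
    summand-at c k α = ≡.trans (cong (_$ α) (when-coeff (not (lookup U c)) _ k)) (when-at (not (lookup U c)) _ α)
    sum-at : ∀ k α → sum summand k α ≡ ℕΣ.sum (λ c → summand c k α)
    sum-at k α = ≡.trans (cong (_$ α) (∑-coeff summand k)) (∑-at (λ c → summand c k) α)
    coefficient : ∀ k → tD (Eout U) k ≗ sum summand k
    coefficient zero α = ≡.sym (≡.trans (sum-at 0 α) (∑-zero _ λ c →
      ≡.trans (summand-at c 0 α)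
        (≡.trans (cong (ℕΣ.when (not (lookup U c))) (Z-⊠-zero c (Eout (U [ c ]≔ inside)) α)) (if-eta (not (lookup U c))))))
    coefficient (suc k) α = ≡.trans (eOutside-derivative U k α) (≡.sym (≡.trans (sum-at (suc k) α)
      (ℕΣ.sum-cong-≗ λ c → ≡.trans (summand-at c (suc k) α)
        (cong (ℕΣ.when (not (lookup U c))) (≡.trans (Z-⊠-suc c _ k α) (x[]-⊛ c (eOutside (U [ c ]≔ inside) k) α))))))

  scaled-cong : ∀ s {F G} → F ≋ G → scaled s F ≋ scaled s G
  scaled-cong s F≋G k α = cong (s k *_) (F≋G k α)

  scaled-∑ : ∀ s {n} (F : Fin n → PowerSeries) → scaled s (∑[ c < n ] F c) ≋ ∑[ c < n ] scaled s (F c)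
  scaled-∑ s {zero}  F k α = *-zeroʳ (s k)
  scaled-∑ s {suc n} F k α = ≡.trans (*-distribˡ-+ (s k) (F zero k α) _) (cong (_ +_) (scaled-∑ s (F ∘ suc) k α))

  scaled-Z : ∀ c H → scaled (_∸ 1) (Z c ⊠ H) ≋ Z c ⊠ tD H
  scaled-Z c H zero    α = ≡.sym (Z-⊠-zero c (tD H) α)
  scaled-Z c H (suc k) α = begin
    k * (Z c ⊠ H) (suc k) α        ≡⟨ cong (k *_) (Z-⊠-suc c H k α) ⟩
    k * (x[ c ] ⊛ H k) α           ≡⟨ ⊛-scaleʳ k x[ c ] (H k) α ⟨
    (x[ c ] ⊛ (k · H k)) α         ≡⟨ Z-⊠-suc c (tD H) k α ⟨
    (Z c ⊠ tD H) (suc k) α  ∎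
    where open ≡.≡-Reasoning

  E₁ : Fin N → PowerSeries
  E₁ c = Eout (⊥ [ c ]≔ inside)

  E₂ : Fin N → Fin N → PowerSeries
  E₂ c d = Eout (⊥ [ c ]≔ inside [ d ]≔ inside)

  E-split : ∀ c → E ≋ (𝟙 ⊞ Z c) ⊠ E₁ c
  E-split c = 𝕋.trans E≋Eout⊥ (Eout-split ⊥ c (lookup-replicate c outside))

  E-split₂ : ∀ c d → finEq d c ≡ false → E ≋ (𝟙 ⊞ Z c) ⊠ ((𝟙 ⊞ Z d) ⊠ E₂ c d)
  E-split₂ c d d≢c = 𝕋.trans (E-split c)
    (𝕋.*-congˡ {𝟙 ⊞ Z c} (Eout-split (⊥ [ c ]≔ inside) d (≡.trans (lookup-⊥-insert c d) d≢c)))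

  tD-E : tD E ≋ ∑[ c < N ] (Z c ⊠ E₁ c)
  tD-E = 𝕋.trans (scaled-cong id E≋Eout⊥) (𝕋.trans (Eout-derivative ⊥)
    (𝕋Σ.sum-cong-≋ λ c → 𝕋.reflexive (cong (λ b → when (not b) (Z c ⊠ E₁ c)) (lookup-replicate c outside))))

  t²D²-E : t²D² E ≋ ∑[ c < N ] ∑[ d < N ] when (not (finEq d c)) (Z c ⊠ (Z d ⊠ E₂ c d))
  t²D²-E = begin
    t²D² E
      ≈⟨ (λ k α → ≡.trans (cong (_* e k α) (*-comm k (k ∸ 1))) (*-assoc (k ∸ 1) k (e k α))) ⟩
    scaled (_∸ 1) (tD E)
      ≈⟨ scaled-cong (_∸ 1) tD-E ⟩
    scaled (_∸ 1) (∑[ c < N ] (Z c ⊠ E₁ c))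
      ≈⟨ scaled-∑ (_∸ 1) (λ c → Z c ⊠ E₁ c) ⟩
    ∑[ c < N ] scaled (_∸ 1) (Z c ⊠ E₁ c)
      ≈⟨ 𝕋Σ.sum-cong-≋ (λ c →
           𝕋.trans (scaled-Z c (E₁ c)) (𝕋.*-congˡ {Z c} (Eout-derivative (⊥ [ c ]≔ inside)))) ⟩
    ∑[ c < N ] (Z c ⊠ ∑[ d < N ] when (not (lookup (⊥ [ c ]≔ inside) d)) (Z d ⊠ E₂ c d))
      ≈⟨ 𝕋Σ.sum-cong-≋ (λ c → 𝕋.trans
           (𝕋Σ.*-distribˡ-∑-when (Z c) (λ d → not (lookup (⊥ [ c ]≔ inside) d)) (λ d → Z d ⊠ E₂ c d))
           (𝕋Σ.sum-cong-≋ λ d → 𝕋.reflexive (cong (λ b → when (not b) (Z c ⊠ (Z d ⊠ E₂ c d))) (lookup-⊥-insert c d)))) ⟩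
    ∑[ c < N ] ∑[ d < N ] when (not (finEq d c)) (Z c ⊠ (Z d ⊠ E₂ c d)) ∎
    where open import Relation.Binary.Reasoning.Setoid 𝕋.setoid

-- Smirnov words

finEq-sym : ∀ {N} (a b : Fin N) → finEq a b ≡ finEq b a
finEq-sym zero    zero    = refl
finEq-sym zero    (suc b) = refl
finEq-sym (suc a) zero    = refl
finEq-sym (suc a) (suc b) = finEq-sym a b

finEq-refl : ∀ {N} (a : Fin N) → finEq a a ≡ true
finEq-refl zero    = refl
finEq-refl (suc a) = finEq-refl a

apart : ∀ {N} → Maybe (Fin N) → Maybe (Fin N) → Bool
apart (just a) (just b) = not (finEq a b)
apart _        _        = true

module SmirnovSeries (N : ℕ) where

  open GeneratingSeries N
  open import Relation.Binary.Reasoning.Setoid 𝕊.setoid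

  [_≠_] : Maybe (Fin N) → Maybe (Fin N) → Series N → Series N
  [ p ≠ q ] = 𝕊Σ.when (apart p q)

  -- smirnov p q j counts, by their monomials, the words of length j without two equal adjacent letters
  -- that differ from the letter p before them and q after them; nothing stands for no neighbour.
  smirnov : Maybe (Fin N) → Maybe (Fin N) → PowerSeries
  smirnov p q zero    = [ p ≠ q ] oneS
  smirnov p q (suc j) = 𝕊Σ.sum λ d → [ p ≠ just d ] (x[ d ] ⊛ smirnov (just d) q j)

  smirnov-last-letter : ∀ p q j → smirnov p q (suc j) ≗ 𝕊Σ.sum λ d → [ just d ≠ q ] (smirnov p (just d) j ⊛ x[ d ])
  smirnov-last-letter p q zero = 𝕊Σ.sum-cong-≋ λ d → begin
    [ p ≠ just d ] (x[ d ] ⊛ [ just d ≠ q ] oneS)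
      ≈⟨ 𝕊Σ.when-cong (apart p (just d)) (𝕊Σ.*-when (apart (just d) q) x[ d ] oneS) ⟩
    [ p ≠ just d ] ([ just d ≠ q ] (x[ d ] ⊛ oneS))
      ≡⟨ if-swap-then (apart p (just d)) (apart (just d) q) ⟩
    [ just d ≠ q ] ([ p ≠ just d ] (x[ d ] ⊛ oneS))
      ≈⟨ 𝕊Σ.when-cong (apart (just d) q) (𝕊Σ.when-cong (apart p (just d)) (𝕊.*-comm x[ d ] oneS)) ⟩
    [ just d ≠ q ] ([ p ≠ just d ] (oneS ⊛ x[ d ]))
      ≈⟨ 𝕊Σ.when-cong (apart (just d) q) (𝕊.sym (𝕊Σ.when-* (apart p (just d)) oneS x[ d ])) ⟩
    [ just d ≠ q ] (smirnov p (just d) 0 ⊛ x[ d ]) ∎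
  smirnov-last-letter p q (suc j) = begin
    𝕊Σ.sum (λ a → [ p ≠ just a ] (x[ a ] ⊛ smirnov (just a) q (suc j)))
      ≈⟨ 𝕊Σ.sum-cong-≋ (λ a →
           𝕊Σ.when-cong (apart p (just a)) (𝕊.*-congˡ {x[ a ]} (smirnov-last-letter (just a) q j))) ⟩
    𝕊Σ.sum (λ a → [ p ≠ just a ] (x[ a ] ⊛ 𝕊Σ.sum (ending a)))
      ≈⟨ 𝕊Σ.sum-cong-≋ (λ a → 𝕊.trans (𝕊Σ.when-cong (apart p (just a)) (𝕊Σ.*-distribˡ-sum x[ a ] (ending a)))
                                        (𝕊Σ.when-sum (apart p (just a)) (λ d → x[ a ] ⊛ ending a d))) ⟩
    𝕊Σ.sum (λ a → 𝕊Σ.sum λ d → [ p ≠ just a ] (x[ a ] ⊛ ending a d))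
      ≈⟨ 𝕊Σ.∑-comm (λ a d → [ p ≠ just a ] (x[ a ] ⊛ ending a d)) ⟩
    𝕊Σ.sum (λ d → 𝕊Σ.sum λ a → [ p ≠ just a ] (x[ a ] ⊛ ending a d))
      ≈⟨ 𝕊Σ.sum-cong-≋ (λ d → 𝕊Σ.sum-cong-≋ (λ a → regroup a d)) ⟩
    𝕊Σ.sum (λ d → 𝕊Σ.sum λ a → [ just d ≠ q ] (starting d a ⊛ x[ d ]))
      ≈⟨ 𝕊Σ.sum-cong-≋ (λ d → 𝕊.trans (𝕊.sym (𝕊Σ.when-sum (apart (just d) q) (λ a → starting d a ⊛ x[ d ])))
                                        (𝕊Σ.when-cong (apart (just d) q) (𝕊.sym (𝕊Σ.*-distribʳ-sum x[ d ] (starting d))))) ⟩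
    𝕊Σ.sum (λ d → [ just d ≠ q ] (smirnov p (just d) (suc j) ⊛ x[ d ])) ∎
    where
    inner : Fin N → Fin N → Series N
    inner a d = smirnov (just a) (just d) j
    ending : Fin N → Fin N → Series N
    ending a d = [ just d ≠ q ] (inner a d ⊛ x[ d ])
    starting : Fin N → Fin N → Series N
    starting d a = [ p ≠ just a ] (x[ a ] ⊛ inner a d)
    regroup : ∀ a d → [ p ≠ just a ] (x[ a ] ⊛ ending a d) 𝕊.≈ [ just d ≠ q ] (starting d a ⊛ x[ d ])
    regroup a d = begin
      [ p ≠ just a ] (x[ a ] ⊛ [ just d ≠ q ] (inner a d ⊛ x[ d ]))
        ≈⟨ 𝕊Σ.when-cong (apart p (just a)) (𝕊Σ.*-when (apart (just d) q) x[ a ] (inner a d ⊛ x[ d ])) ⟩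
      [ p ≠ just a ] ([ just d ≠ q ] (x[ a ] ⊛ (inner a d ⊛ x[ d ])))
        ≡⟨ if-swap-then (apart p (just a)) (apart (just d) q) ⟩
      [ just d ≠ q ] ([ p ≠ just a ] (x[ a ] ⊛ (inner a d ⊛ x[ d ])))
        ≈⟨ 𝕊Σ.when-cong (apart (just d) q)
             (𝕊Σ.when-cong (apart p (just a)) (𝕊.sym (𝕊.*-assoc x[ a ] (inner a d) x[ d ]))) ⟩
      [ just d ≠ q ] ([ p ≠ just a ] ((x[ a ] ⊛ inner a d) ⊛ x[ d ]))
        ≈⟨ 𝕊Σ.when-cong (apart (just d) q) (𝕊.sym (𝕊Σ.when-* (apart p (just a)) (x[ a ] ⊛ inner a d) x[ d ])) ⟩
      [ just d ≠ q ] (starting d a ⊛ x[ d ]) ∎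

  series-by-first-letter : ∀ {F} b (bs : Fin N → Bool) (H : Fin N → PowerSeries) →
    F 0 ≗ 𝕊Σ.when b oneS → (∀ j → F (suc j) ≗ 𝕊Σ.sum λ d → 𝕊Σ.when (bs d) (x[ d ] ⊛ H d j)) →
    F ≋ when b 𝟙 ⊞ ∑[ d < N ] when (bs d) (Z d ⊠ H d)
  series-by-first-letter {F} b bs H F₀ F₊ zero = begin
    F 0
      ≈⟨ F₀ ⟩
    𝕊Σ.when b oneS
      ≈⟨ 𝕊.sym (𝕊.+-identityʳ (𝕊Σ.when b oneS)) ⟩
    𝕊Σ.when b oneS ⊕ zeroS
      ≈⟨ 𝕊.+-congˡ {𝕊Σ.when b oneS} vanishing ⟨
    𝕊Σ.when b oneS ⊕ 𝕊Σ.sum (λ d → 𝕊Σ.when (bs d) ((Z d ⊠ H d) 0))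
      ≈⟨ 𝕊.+-cong (𝕊.reflexive (when-coeff b 𝟙 0)) (∑-when-coeff bs (λ d → Z d ⊠ H d) 0) ⟨
    (when b 𝟙 ⊞ ∑[ d < N ] when (bs d) (Z d ⊠ H d)) 0 ∎
    where
    vanishing : 𝕊Σ.sum (λ d → 𝕊Σ.when (bs d) ((Z d ⊠ H d) 0)) 𝕊.≈ zeroS
    vanishing = 𝕊.trans
      (𝕊Σ.sum-cong-≋ λ d → 𝕊.trans (𝕊Σ.when-cong (bs d) (Z-⊠-zero d (H d))) (𝕊.reflexive (if-eta (bs d))))
      (𝕊Σ.sum-replicate-zero N)
  series-by-first-letter {F} b bs H F₀ F₊ (suc j) = begin
    F (suc j)
      ≈⟨ F₊ j ⟩
    𝕊Σ.sum (λ d → 𝕊Σ.when (bs d) (x[ d ] ⊛ H d j))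
      ≈⟨ 𝕊Σ.sum-cong-≋ (λ d → 𝕊Σ.when-cong (bs d) (Z-⊠-suc d (H d) j)) ⟨
    𝕊Σ.sum (λ d → 𝕊Σ.when (bs d) ((Z d ⊠ H d) (suc j)))
      ≈⟨ 𝕊.+-identityˡ _ ⟨
    zeroS ⊕ 𝕊Σ.sum (λ d → 𝕊Σ.when (bs d) ((Z d ⊠ H d) (suc j)))
      ≈⟨ 𝕊.+-cong (𝕊.reflexive (≡.trans (when-coeff b 𝟙 (suc j)) (if-eta b)))
                  (∑-when-coeff bs (λ d → Z d ⊠ H d) (suc j)) ⟨
    (when b 𝟙 ⊞ ∑[ d < N ] when (bs d) (Z d ⊠ H d)) (suc j) ∎

  smirnov-first : ∀ p q → smirnov p q ≋ when (apart p q) 𝟙 ⊞ ∑[ d < N ] when (apart p (just d)) (Z d ⊠ smirnov (just d) q)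
  smirnov-first p q = series-by-first-letter (apart p q) (λ d → apart p (just d)) (λ d → smirnov (just d) q)
    (λ _ → refl) (λ j _ → refl)

  smirnov-last : ∀ p q → smirnov p q ≋ when (apart p q) 𝟙 ⊞ ∑[ d < N ] when (apart (just d) q) (smirnov p (just d) ⊠ Z d)
  smirnov-last p q = 𝕋.trans
    (series-by-first-letter (apart p q) (λ d → apart (just d) q) (λ d → smirnov p (just d))
      (λ _ → refl) λ j → 𝕊.trans (smirnov-last-letter p q j)
        (𝕊Σ.sum-cong-≋ λ d → 𝕊Σ.when-cong (apart (just d) q) (𝕊.*-comm (smirnov p (just d) j) x[ d ])))
    (𝕋.+-congˡ (𝕋Σ.sum-cong-≋ λ d → 𝕋Σ.when-cong (apart (just d) q) (⊠-comm (Z d) (smirnov p (just d)))))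

module SmirnovIdentities (N : ℕ) where

  open GeneratingSeries N
  open SmirnovSeries N
  open import Algebra.Solver.Ring.NaturalCoefficients.Default powerSeriesSemiring
  open import Relation.Binary.Reasoning.Setoid 𝕋.setoid

  S : PowerSeries
  S = smirnov nothing nothing

  S₁ : Fin N → PowerSeries
  S₁ c = smirnov (just c) nothing

  S₂ : Fin N → Fin N → PowerSeries
  S₂ c d = smirnov (just c) (just d)

  +-rotate : ∀ F G H → F ⊞ (G ⊞ H) ≋ (F ⊞ H) ⊞ G
  +-rotate = solve 3 (λ f g h → f :+ (g :+ h) := (f :+ h) :+ g) 𝕋.refl

  S-first : S ≋ 𝟙 ⊞ ∑[ c < N ] (Z c ⊠ S₁ c)
  S-first = smirnov-first nothing nothing

  S-split : ∀ c → S ≋ (𝟙 ⊞ Z c) ⊠ S₁ c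
  S-split c = begin
    S                              ≈⟨ S-first ⟩
    𝟙 ⊞ ∑[ d < N ] (Z d ⊠ S₁ d)    ≈⟨ 𝕋.+-congˡ {𝟙} (𝕋Σ.∑-pick c (λ d → Z d ⊠ S₁ d)) ⟩
    𝟙 ⊞ (Z c ⊠ S₁ c ⊞ others)      ≈⟨ +-rotate 𝟙 (Z c ⊠ S₁ c) others ⟩
    (𝟙 ⊞ others) ⊞ Z c ⊠ S₁ c      ≈⟨ 𝕋.+-congʳ (𝕋.sym S₁-first) ⟩
    S₁ c ⊞ Z c ⊠ S₁ c              ≈⟨ 𝕋.+-congʳ (𝕋.*-identityˡ (S₁ c)) ⟨
    𝟙 ⊠ S₁ c ⊞ Z c ⊠ S₁ c          ≈⟨ ⊠-distribʳ (S₁ c) 𝟙 (Z c) ⟨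
    (𝟙 ⊞ Z c) ⊠ S₁ c               ∎
    where
    others = ∑[ d < N ] when (not (finEq d c)) (Z d ⊠ S₁ d)
    S₁-first : S₁ c ≋ 𝟙 ⊞ others
    S₁-first = 𝕋.trans (smirnov-first (just c) nothing)
      (𝕋.+-congˡ {𝟙} (𝕋Σ.sum-cong-≋ λ d → 𝕋.reflexive (cong (λ b → when (not b) (Z d ⊠ S₁ d)) (finEq-sym c d))))

  S₁-split : ∀ c d → finEq c d ≡ false → S₁ c ≋ S₂ c d ⊠ (𝟙 ⊞ Z d)
  S₁-split c d c≢d = begin
    S₁ c                                        ≈⟨ smirnov-last (just c) nothing ⟩
    𝟙 ⊞ ∑[ e < N ] (S₂ c e ⊠ Z e)               ≈⟨ 𝕋.+-congˡ {𝟙} (𝕋Σ.∑-pick d (λ e → S₂ c e ⊠ Z e)) ⟩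
    𝟙 ⊞ (S₂ c d ⊠ Z d ⊞ others)                 ≈⟨ +-rotate 𝟙 (S₂ c d ⊠ Z d) others ⟩
    (𝟙 ⊞ others) ⊞ S₂ c d ⊠ Z d                 ≈⟨ 𝕋.+-congʳ (𝕋.sym S₂-last) ⟩
    S₂ c d ⊞ S₂ c d ⊠ Z d                       ≈⟨ 𝕋.+-congʳ (𝕋.*-identityʳ (S₂ c d)) ⟨
    S₂ c d ⊠ 𝟙 ⊞ S₂ c d ⊠ Z d                   ≈⟨ 𝕋.distribˡ (S₂ c d) 𝟙 (Z d) ⟨
    S₂ c d ⊠ (𝟙 ⊞ Z d)                          ∎
    where
    others = ∑[ e < N ] when (not (finEq e d)) (S₂ c e ⊠ Z e)
    S₂-last : S₂ c d ≋ 𝟙 ⊞ others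
    S₂-last = 𝕋.trans (smirnov-last (just c) (just d))
      (𝕋.+-congʳ (𝕋.reflexive (cong (λ b → when (not b) 𝟙) c≢d)))

  S₂-diagonal : ∀ c → S₂ c c ≋ ∑[ e < N ] when (not (finEq e c)) (S₂ c e ⊠ Z e)
  S₂-diagonal c = 𝕋.trans (smirnov-last (just c) (just c))
    (𝕋.trans (𝕋.+-congʳ (𝕋.reflexive (cong (λ b → when (not b) 𝟙) (finEq-refl c)))) (𝕋.+-identityˡ _))

  -- Both E and S factor through 1 + x_c t, so the factor can be moved from S to E.
  E⊠S : E ⊠ S ≋ E ⊞ tD E ⊠ S
  E⊠S = begin
    E ⊠ S
      ≈⟨ 𝕋.*-congˡ {E} S-first ⟩
    E ⊠ (𝟙 ⊞ ∑[ c < N ] (Z c ⊠ S₁ c))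
      ≈⟨ 𝕋.distribˡ E 𝟙 _ ⟩
    E ⊠ 𝟙 ⊞ E ⊠ ∑[ c < N ] (Z c ⊠ S₁ c)
      ≈⟨ 𝕋.+-cong (𝕋.*-identityʳ E) (𝕋Σ.*-distribˡ-sum E (λ c → Z c ⊠ S₁ c)) ⟩
    E ⊞ ∑[ c < N ] (E ⊠ (Z c ⊠ S₁ c))
      ≈⟨ 𝕋.+-congˡ {E} (𝕋Σ.sum-cong-≋ regroup) ⟩
    E ⊞ ∑[ c < N ] ((Z c ⊠ E₁ c) ⊠ S)
      ≈⟨ 𝕋.+-congˡ {E} (𝕋Σ.*-distribʳ-sum S (λ c → Z c ⊠ E₁ c)) ⟨
    E ⊞ ∑[ c < N ] (Z c ⊠ E₁ c) ⊠ S
      ≈⟨ 𝕋.+-congˡ {E} (𝕋.*-congʳ tD-E) ⟨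
    E ⊞ tD E ⊠ S ∎
    where
    regroup : ∀ c → E ⊠ (Z c ⊠ S₁ c) ≋ (Z c ⊠ E₁ c) ⊠ S
    regroup c = begin
      E ⊠ (Z c ⊠ S₁ c)
        ≈⟨ 𝕋.*-congʳ (E-split c) ⟩
      ((𝟙 ⊞ Z c) ⊠ E₁ c) ⊠ (Z c ⊠ S₁ c)
        ≈⟨ solve 4 (λ o z e s → ((o :+ z) :* e) :* (z :* s) := (z :* e) :* ((o :+ z) :* s)) 𝕋.refl 𝟙 (Z c) (E₁ c) (S₁ c) ⟩
      (Z c ⊠ E₁ c) ⊠ ((𝟙 ⊞ Z c) ⊠ S₁ c)
        ≈⟨ 𝕋.*-congˡ {Z c ⊠ E₁ c} (S-split c) ⟨
      (Z c ⊠ E₁ c) ⊠ S ∎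

  C : PowerSeries
  C = ∑[ c < N ] (Z c ⊠ S₂ c c)

  -- As for E⊠S, now moving 1 + x_c t and 1 + x_d t, where c and d are the first and last letters.
  E⊠C : E ⊠ C ≋ t²D² E ⊠ S
  E⊠C = begin
    E ⊠ C
      ≈⟨ 𝕋Σ.*-distribˡ-sum E (λ c → Z c ⊠ S₂ c c) ⟩
    ∑[ c < N ] (E ⊠ (Z c ⊠ S₂ c c))
      ≈⟨ 𝕋Σ.sum-cong-≋ (λ c → 𝕋.*-congˡ {E} (𝕋.*-congˡ {Z c} (S₂-diagonal c))) ⟩
    ∑[ c < N ] (E ⊠ (Z c ⊠ ∑[ d < N ] when (not (finEq d c)) (S₂ c d ⊠ Z d)))
      ≈⟨ 𝕋Σ.sum-cong-≋ (λ c → 𝕋.trans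
           (𝕋.*-congˡ {E} (𝕋Σ.*-distribˡ-∑-when (Z c) (λ d → not (finEq d c)) (λ d → S₂ c d ⊠ Z d)))
           (𝕋Σ.*-distribˡ-∑-when E (λ d → not (finEq d c)) (λ d → Z c ⊠ (S₂ c d ⊠ Z d)))) ⟩
    ∑[ c < N ] ∑[ d < N ] when (not (finEq d c)) (E ⊠ (Z c ⊠ (S₂ c d ⊠ Z d)))
      ≈⟨ 𝕋Σ.sum-cong-≋ (λ c → 𝕋Σ.sum-cong-≋ λ d → 𝕋Σ.when-not-cong (finEq d c) (regroup c d)) ⟩
    ∑[ c < N ] ∑[ d < N ] when (not (finEq d c)) ((Z c ⊠ (Z d ⊠ E₂ c d)) ⊠ S)
      ≈⟨ 𝕋Σ.sum-cong-≋ (λ c →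
           𝕋Σ.*-distribʳ-∑-when S (λ d → not (finEq d c)) (λ d → Z c ⊠ (Z d ⊠ E₂ c d))) ⟨
    ∑[ c < N ] ((∑[ d < N ] when (not (finEq d c)) (Z c ⊠ (Z d ⊠ E₂ c d))) ⊠ S)
      ≈⟨ 𝕋Σ.*-distribʳ-sum S (λ c → ∑[ d < N ] when (not (finEq d c)) (Z c ⊠ (Z d ⊠ E₂ c d))) ⟨
    (∑[ c < N ] ∑[ d < N ] when (not (finEq d c)) (Z c ⊠ (Z d ⊠ E₂ c d))) ⊠ S
      ≈⟨ 𝕋.*-congʳ t²D²-E ⟨
    t²D² E ⊠ S ∎
    where
    regroup : ∀ c d → finEq d c ≡ false → E ⊠ (Z c ⊠ (S₂ c d ⊠ Z d)) ≋ (Z c ⊠ (Z d ⊠ E₂ c d)) ⊠ S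
    regroup c d d≢c = begin
      E ⊠ (Z c ⊠ (S₂ c d ⊠ Z d))
        ≈⟨ 𝕋.*-congʳ (E-split₂ c d d≢c) ⟩
      ((𝟙 ⊞ Z c) ⊠ ((𝟙 ⊞ Z d) ⊠ E₂ c d)) ⊠ (Z c ⊠ (S₂ c d ⊠ Z d))
        ≈⟨ solve 5 (λ o z z′ e s → ((o :+ z) :* ((o :+ z′) :* e)) :* (z :* (s :* z′))
                               := (z :* (z′ :* e)) :* ((o :+ z) :* (s :* (o :+ z′))))
             𝕋.refl 𝟙 (Z c) (Z d) (E₂ c d) (S₂ c d) ⟩
      (Z c ⊠ (Z d ⊠ E₂ c d)) ⊠ ((𝟙 ⊞ Z c) ⊠ (S₂ c d ⊠ (𝟙 ⊞ Z d)))
        ≈⟨ 𝕋.*-congˡ {Z c ⊠ (Z d ⊠ E₂ c d)}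
             (𝕋.trans (S-split c) (𝕋.*-congˡ {𝟙 ⊞ Z c} (S₁-split c d (≡.trans (finEq-sym c d) d≢c)))) ⟨
      (Z c ⊠ (Z d ⊠ E₂ c d)) ⊠ S ∎

-- Compositions

raiseHead : List ℕ → List (List ℕ)
raiseHead []      = []
raiseHead (i ∷ I) = [ suc i ∷ I ]

compositions-suc : ∀ n → compositions (suc n) ≡ map (1 ∷_) (compositions n) ++ concatMap raiseHead (compositions n)
compositions-suc n = cong (map (1 ∷_) (compositions n) ++_)
  (List.concatMap-cong (λ { [] → refl ; (i ∷ I) → refl }) (compositions n))

module CompositionSeries (N : ℕ) where

  open GeneratingSeries N
  open 𝕊Σ using (Σˡ-++; Σˡ-cong; Σˡ-map-concatMap; *-distribˡ-Σˡ)

  overCompositions : (List ℕ → Series N) → PowerSeries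
  overCompositions F n = sumS (map F (compositions n))

  antidiagonal : (ℕ → ℕ → Series N) → ℕ → Series N
  antidiagonal A zero    = A 0 0
  antidiagonal A (suc n) = A 0 (suc n) ⊕ antidiagonal (A ∘ suc) n

  antidiagonal-cong : ∀ {A B} → (∀ k j → A k j 𝕊.≈ B k j) → ∀ n → antidiagonal A n 𝕊.≈ antidiagonal B n
  antidiagonal-cong A≈B zero    = A≈B 0 0
  antidiagonal-cong A≈B (suc n) = 𝕊.+-cong (A≈B 0 (suc n)) (antidiagonal-cong (A≈B ∘ suc) n)

  ⊠-antidiagonal : ∀ f g n → (f ⊠ g) n 𝕊.≈ antidiagonal (λ k j → f k ⊛ g j) n
  ⊠-antidiagonal f g zero    = 𝕊.refl
  ⊠-antidiagonal f g (suc n) = 𝕊.+-congˡ (⊠-antidiagonal (f ∘ suc) g n)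

  overCompositions-first : ∀ F n →
    overCompositions F (suc n) 𝕊.≈ antidiagonal (λ k → overCompositions (F ∘ (suc k ∷_))) n
  overCompositions-first F zero    = 𝕊.refl
  overCompositions-first F (suc n) = begin
    sumS (map F (compositions (suc (suc n))))
      ≡⟨ cong (sumS ∘ map F) (compositions-suc (suc n)) ⟩
    sumS (map F (map (1 ∷_) (compositions (suc n)) ++ concatMap raiseHead (compositions (suc n))))
      ≡⟨ cong sumS (List.map-++ F (map (1 ∷_) (compositions (suc n))) (concatMap raiseHead (compositions (suc n)))) ⟩
    sumS (map F (map (1 ∷_) (compositions (suc n))) ++ map F (concatMap raiseHead (compositions (suc n))))
      ≈⟨ Σˡ-++ (map F (map (1 ∷_) (compositions (suc n)))) _ ⟩
    sumS (map F (map (1 ∷_) (compositions (suc n)))) ⊕ sumS (map F (concatMap raiseHead (compositions (suc n))))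
      ≈⟨ 𝕊.+-cong (𝕊.reflexive (cong sumS (≡.sym (List.map-∘ (compositions (suc n))))))
                  (𝕊.trans (Σˡ-map-concatMap F raiseHead (compositions (suc n))) (overCompositions-first raised n)) ⟩
    overCompositions (F ∘ (1 ∷_)) (suc n) ⊕ antidiagonal (λ k → overCompositions (raised ∘ (suc k ∷_))) n
      ≈⟨ 𝕊.+-congˡ (antidiagonal-cong (λ k j →
           Σˡ-cong (λ I → 𝕊.+-identityʳ (F (suc (suc k) ∷ I))) (compositions j)) n) ⟩
    antidiagonal (λ k → overCompositions (F ∘ (suc k ∷_))) (suc n) ∎
    where
    open import Relation.Binary.Reasoning.Setoid 𝕊.setoid
    raised : List ℕ → Series N
    raised I = sumS (map F (raiseHead I))

  overCompositions-⊠ : ∀ (F H : List ℕ → Series N) G → G 0 𝕊.≈ zeroS →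
    (∀ k I → F (suc k ∷ I) 𝕊.≈ G (suc k) ⊛ H I) →
    ∀ n → overCompositions F (suc n) 𝕊.≈ (G ⊠ overCompositions H) (suc n)
  overCompositions-⊠ F H G G₀≈0 F≈GH n = begin
    overCompositions F (suc n)
      ≈⟨ overCompositions-first F n ⟩
    antidiagonal (λ k → overCompositions (F ∘ (suc k ∷_))) n
      ≈⟨ antidiagonal-cong (λ k j → 𝕊.trans (Σˡ-cong (F≈GH k) (compositions j))
                                              (𝕊.sym (*-distribˡ-Σˡ (G (suc k)) H (compositions j)))) n ⟩
    antidiagonal (λ k j → G (suc k) ⊛ overCompositions H j) n
      ≈⟨ ⊠-antidiagonal (G ∘ suc) (overCompositions H) n ⟨
    ((G ∘ suc) ⊠ overCompositions H) n
      ≈⟨ 𝕊.+-identityˡ _ ⟨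
    zeroS ⊕ ((G ∘ suc) ⊠ overCompositions H) n
      ≈⟨ 𝕊.+-congʳ (𝕊.trans (𝕊.*-congʳ {overCompositions H (suc n)} G₀≈0) (𝕊.zeroˡ (overCompositions H (suc n)))) ⟨
    (G ⊠ overCompositions H) (suc n) ∎
    where open import Relation.Binary.Reasoning.Setoid 𝕊.setoid

  tailWeight : List ℕ → ℕ
  tailWeight I = ℕ.product (map (_∸ 1) I)

  tailTerm wTerm cycleTerm : List ℕ → Series N
  tailTerm  I = tailWeight I · eC I
  wTerm     I = w I · eC I
  cycleTerm J = ((firstPart J ∸ 1) * w J) · eC J

  eTail ePath eCycle : PowerSeries
  eTail  = overCompositions tailTerm
  ePath  = overCompositions wTerm
  eCycle = overCompositions cycleTerm

  overCompositions-zero : ∀ F X H → F [] 𝕊.≈ oneS → X 0 𝕊.≈ zeroS → overCompositions F 0 𝕊.≈ (𝟙 ⊞ X ⊠ H) 0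
  overCompositions-zero F X H F[]≈1 X₀≈0 = 𝕊.trans (𝕊.+-identityʳ (F [])) (𝕊.trans F[]≈1
    (𝕊.sym (𝕊.trans (𝕊.+-congˡ (𝕊.trans (𝕊.*-congʳ {H 0} X₀≈0) (𝕊.zeroˡ (H 0)))) (𝕊.+-identityʳ oneS))))

  eTail-rec : eTail ≋ 𝟙 ⊞ scaled (_∸ 1) E ⊠ eTail
  eTail-rec zero    = overCompositions-zero tailTerm (scaled (_∸ 1) E) eTail (λ α → +-identityʳ _) (λ α → refl)
  eTail-rec (suc n) = overCompositions-⊠ tailTerm tailTerm (scaled (_∸ 1) E) (λ _ → refl)
    (λ k I → 𝕊.sym (scale-⊛-scale k (tailWeight I) (e (suc k)) (eC I))) n

  ePath-rec : ePath ≋ 𝟙 ⊞ tD E ⊠ eTail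
  ePath-rec zero    = overCompositions-zero wTerm (tD E) eTail (λ α → +-identityʳ _) (λ α → refl)
  ePath-rec (suc n) = overCompositions-⊠ wTerm tailTerm (tD E) (λ _ → refl)
    (λ k I → 𝕊.sym (scale-⊛-scale (suc k) (tailWeight I) (e (suc k)) (eC I))) n

  eCycle-rec : eCycle ≋ t²D² E ⊠ eTail
  eCycle-rec zero    α = ≡.sym (𝕊.zeroˡ (eTail 0) α)
  eCycle-rec (suc n) = overCompositions-⊠ cycleTerm tailTerm (t²D² E) (λ _ → refl)
    (λ k I → 𝕊.trans (λ α → cong (_* eC (suc k ∷ I) α) (weight k (tailWeight I)))
                     (𝕊.sym (scale-⊛-scale (suc k * k) (tailWeight I) (e (suc k)) (eC I)))) n
    where
    weight : ∀ k t → k * (suc k * t) ≡ (suc k * k) * t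
    weight k t = ≡.trans (≡.sym (*-assoc k (suc k) t)) (cong (_* t) (*-comm k (suc k)))

module SeriesIdentities (N : ℕ) where

  open GeneratingSeries N
  open SmirnovIdentities N
  open CompositionSeries N
  open import Algebra.Solver.Ring.NaturalCoefficients.Default powerSeriesSemiring
  open import Relation.Binary.Reasoning.Setoid 𝕋.setoid

  private
    D E′ U : PowerSeries
    D  = scaled (_∸ 1) E
    E′ = tD E
    U  = E ⊠ eTail

  ⊕-cancelʳ : ∀ (h f g : Series N) → f ⊕ h ≗ g ⊕ h → f ≗ g
  ⊕-cancelʳ h f g f+h≗g+h α = +-cancelʳ-≡ (h α) (f α) (g α) (f+h≗g+h α)

  𝟙⊞-⊠ : ∀ F G → (𝟙 ⊞ F) ⊠ G ≋ G ⊞ F ⊠ G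
  𝟙⊞-⊠ F G = 𝕋.trans (⊠-distribʳ G 𝟙 F) (𝕋.+-congʳ (𝕋.*-identityˡ G))

  ⊠-⊞𝟙 : ∀ F G → F ⊠ (𝟙 ⊞ G) ≋ F ⊠ G ⊞ F
  ⊠-⊞𝟙 F G = 𝕋.trans (𝕋.distribˡ F 𝟙 G) (𝕋.trans (𝕋.+-congʳ (𝕋.*-identityʳ F)) (𝕋.+-comm F (F ⊠ G)))

  +-swapʳ : ∀ F G H → (F ⊞ G) ⊞ H ≋ (F ⊞ H) ⊞ G
  +-swapʳ = solve 3 (λ f g h → (f :+ g) :+ h := (f :+ h) :+ g) 𝕋.refl

  E₀≈1 : E 0 𝕊.≈ oneS
  E₀≈1 α = ≡.trans (e≗eOutside⊥ 0 α) (eOutside-zero ⊥ α)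

  E+D : E ⊞ D ≋ 𝟙 ⊞ E′
  E+D zero    α = cong (_+ 0) (E₀≈1 α)
  E+D (suc k) α = refl

  U≋ePath : U ≋ ePath
  U≋ePath = ⊞-cancelʳ ⊕-cancelʳ (D ⊠ eTail) U ePath (begin
    E ⊠ eTail ⊞ D ⊠ eTail          ≈⟨ ⊠-distribʳ eTail E D ⟨
    (E ⊞ D) ⊠ eTail                ≈⟨ 𝕋.*-congʳ E+D ⟩
    (𝟙 ⊞ E′) ⊠ eTail               ≈⟨ 𝟙⊞-⊠ E′ eTail ⟩
    eTail ⊞ E′ ⊠ eTail             ≈⟨ 𝕋.+-congʳ eTail-rec ⟩
    (𝟙 ⊞ D ⊠ eTail) ⊞ E′ ⊠ eTail   ≈⟨ +-swapʳ 𝟙 (D ⊠ eTail) (E′ ⊠ eTail) ⟩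
    (𝟙 ⊞ E′ ⊠ eTail) ⊞ D ⊠ eTail   ≈⟨ 𝕋.+-congʳ ePath-rec ⟨
    ePath ⊞ D ⊠ eTail              ∎)

  E⊠U : E ⊠ U ≋ E ⊞ E′ ⊠ U
  E⊠U = ⊞-cancelʳ ⊕-cancelʳ (D ⊠ U) (E ⊠ U) (E ⊞ E′ ⊠ U) (begin
    E ⊠ U ⊞ D ⊠ U         ≈⟨ ⊠-distribʳ U E D ⟨
    (E ⊞ D) ⊠ U           ≈⟨ 𝕋.*-congʳ E+D ⟩
    (𝟙 ⊞ E′) ⊠ U          ≈⟨ 𝟙⊞-⊠ E′ U ⟩
    U ⊞ E′ ⊠ U            ≈⟨ 𝕋.+-congʳ (𝕋.*-congˡ {E} eTail-rec) ⟩
    E ⊠ (𝟙 ⊞ D ⊠ eTail) ⊞ E′ ⊠ U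
      ≈⟨ 𝕋.+-congʳ (𝕋.trans (⊠-⊞𝟙 E (D ⊠ eTail)) (𝕋.+-comm (E ⊠ (D ⊠ eTail)) E)) ⟩
    (E ⊞ E ⊠ (D ⊠ eTail)) ⊞ E′ ⊠ U
      ≈⟨ solve 4 (λ e d t e′ → (e :+ e :* (d :* t)) :+ e′ :* (e :* t) := (e :+ e′ :* (e :* t)) :+ d :* (e :* t))
           𝕋.refl E D eTail E′ ⟩
    (E ⊞ E′ ⊠ U) ⊞ D ⊠ U  ∎)

  S≋ePath : S ≋ ePath
  S≋ePath = 𝕋.trans (⊠-equation-unique ⊕-cancelʳ E₀≈1 (λ α → refl) E⊠S E⊠U) U≋ePath

  C≋eCycle : C ≋ eCycle
  C≋eCycle = ⊠-cancelˡ ⊕-cancelʳ E₀≈1 (begin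
    E ⊠ C             ≈⟨ E⊠C ⟩
    E″ ⊠ S            ≈⟨ 𝕋.*-congˡ {E″} (𝕋.trans S≋ePath (𝕋.sym U≋ePath)) ⟩
    E″ ⊠ (E ⊠ eTail)  ≈⟨ solve 3 (λ a e t → a :* (e :* t) := e :* (a :* t)) 𝕋.refl E″ E eTail ⟩
    E ⊠ (E″ ⊠ eTail)  ≈⟨ 𝕋.*-congˡ {E} eCycle-rec ⟨
    E ⊠ eCycle        ∎)
    where
    E″ = t²D² E

-- Proper colourings of paths and cycles

indicator : Bool → ℕ
indicator b = if b then 1 else 0

count : ∀ {n N} → (Vec (Fin N) n → Bool) → Series N
count {n} {N} P α = ℕΣ.Σˡ (map (λ κ → indicator (P κ ∧ vecEq (colorCount κ) α)) (colorings n N))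

length-filterᵇ : ∀ {A : Set} (p : A → Bool) xs → length (filterᵇ p xs) ≡ ℕΣ.Σˡ (map (indicator ∘ p) xs)
length-filterᵇ p []       = refl
length-filterᵇ p (x ∷ xs) with p x
... | true  = cong suc (length-filterᵇ p xs)
... | false = length-filterᵇ p xs

X≗count : ∀ {N} n adj → X {N} n adj ≗ count (proper adj)
X≗count {N} n adj α = length-filterᵇ _ (colorings n N)

count-cong : ∀ {n N} {P Q : Vec (Fin N) n → Bool} → (∀ κ → P κ ≡ Q κ) → count P ≗ count Q
count-cong {n} {N} P≡Q α = ℕΣ.Σˡ-cong (λ κ → cong (λ b → indicator (b ∧ _)) (P≡Q κ)) (colorings n N)

map-allFin-suc : ∀ {A : Set} n (f : Fin (suc n) → A) → map f (allFin (suc n)) ≡ f zero ∷ map (f ∘ suc) (allFin n)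
map-allFin-suc n f = cong (f zero ∷_) (≡.trans (List.map-tabulate suc f) (≡.sym (List.map-tabulate id (f ∘ suc))))

Σˡ-allFin : ∀ n (f : Fin n → ℕ) → ℕΣ.Σˡ (map f (allFin n)) ≡ ℕΣ.sum f
Σˡ-allFin zero    f = refl
Σˡ-allFin (suc n) f = ≡.trans (cong ℕΣ.Σˡ (map-allFin-suc n f)) (cong (f zero +_) (Σˡ-allFin n (f ∘ suc)))

colorCount-∷ : ∀ {n N} (c : Fin N) (κ : Vec (Fin N) n) → colorCount (c ∷ κ) ≡ colorCount κ [ c ]%= suc
colorCount-∷ c κ = tabulate-raise c (λ d → countᵇ (finEq d) κ)
  where
  tabulate-raise : ∀ {N} (c : Fin N) (f : Fin N → ℕ) →
    tabulate (λ d → (if finEq d c then suc else id) (f d)) ≡ tabulate f [ c ]%= suc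
  tabulate-raise zero    f = refl
  tabulate-raise (suc c) f = cong (f zero ∷_) (tabulate-raise c (f ∘ suc))

vecEq-raise : ∀ {N} (c : Fin N) (v α : Vec ℕ N) →
  vecEq (v [ c ]%= suc) α ≡ (1 ≤ᵇ lookup α c) ∧ vecEq v (α [ c ]%= pred)
vecEq-raise zero    (a ∷ v) (zero  ∷ α) = refl
vecEq-raise zero    (a ∷ v) (suc b ∷ α) = refl
vecEq-raise (suc c) (a ∷ v) (b ∷ α) with 1 ≤ᵇ lookup α c | vecEq-raise c v α
... | true  | eq = cong ((a ≡ᵇ b) ∧_) eq
... | false | eq = ≡.trans (cong ((a ≡ᵇ b) ∧_) eq) (∧-zeroʳ (a ≡ᵇ b))

vecEq-zero : ∀ {N} (α : Vec ℕ N) → vecEq (tabulate (λ (_ : Fin N) → 0)) α ≡ allZero α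
vecEq-zero []          = refl
vecEq-zero (zero  ∷ α) = vecEq-zero α
vecEq-zero (suc _ ∷ α) = refl

count-∷ : ∀ {n N} (P : Vec (Fin N) (suc n) → Bool) α →
  count P α ≡ ℕΣ.sum (λ c → (x[ c ] ⊛ count (P ∘ (c ∷_))) α)
count-∷ {n} {N} P α = begin
  count P α
    ≡⟨ ℕΣ.Σˡ-map-concatMap matches (λ c → map (c ∷_) (colorings n N)) (allFin N) ⟩
  ℕΣ.Σˡ (map (λ c → ℕΣ.Σˡ (map matches (map (c ∷_) (colorings n N)))) (allFin N))
    ≡⟨ Σˡ-allFin N _ ⟩
  ℕΣ.sum (λ c → ℕΣ.Σˡ (map matches (map (c ∷_) (colorings n N))))
    ≡⟨ ℕΣ.sum-cong-≗ (λ c → ≡.trans (cong ℕΣ.Σˡ (≡.sym (List.map-∘ (colorings n N)))) (first-colour c)) ⟩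
  ℕΣ.sum (λ c → (x[ c ] ⊛ count (P ∘ (c ∷_))) α) ∎
  where
  open ≡.≡-Reasoning
  matches : Vec (Fin N) (suc n) → ℕ
  matches κ = indicator (P κ ∧ vecEq (colorCount κ) α)
  first-colour : ∀ c → ℕΣ.Σˡ (map (matches ∘ (c ∷_)) (colorings n N)) ≡ (x[ c ] ⊛ count (P ∘ (c ∷_))) α
  first-colour c = ≡.trans (ℕΣ.Σˡ-cong (λ κ → cong (λ v → indicator (P (c ∷ κ) ∧ v))
      (≡.trans (cong (λ v → vecEq v α) (colorCount-∷ c κ)) (vecEq-raise c (colorCount κ) α))) (colorings n N))
    (≡.trans (occurs (1 ≤ᵇ lookup α c)) (≡.sym (x[]-⊛ c (count (P ∘ (c ∷_))) α)))
    where
    occurs : ∀ b →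
      ℕΣ.Σˡ (map (λ κ → indicator (P (c ∷ κ) ∧ (b ∧ vecEq (colorCount κ) (α [ c ]%= pred)))) (colorings n N))
        ≡ (if b then count (P ∘ (c ∷_)) (α [ c ]%= pred) else 0)
    occurs true  = refl
    occurs false = ≡.trans (ℕΣ.Σˡ-cong (λ κ → cong indicator (∧-zeroʳ (P (c ∷ κ)))) (colorings n N))
                           (ℕΣ.Σˡ-zero (colorings n N))

T-injective : ∀ {a b} → (T a → T b) → (T b → T a) → a ≡ b
T-injective {false} {false} _ _ = refl
T-injective {false} {true}  _ g = ⊥-elim (g tt)
T-injective {true}  {false} f _ = ⊥-elim (f tt)
T-injective {true}  {true}  _ _ = refl

T-∧-intro : ∀ {a b} → T a → T b → T (a ∧ b)
T-∧-intro {true} _ tb = tb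

T-∧-elim : ∀ {a b} → T (a ∧ b) → T a × T b
T-∧-elim {true} tb = tt , tb

T-and-allFin-∷⁻ : ∀ n (f : Fin (suc n) → Bool) →
  T (and (map f (allFin (suc n)))) → T (f zero) × T (and (map (f ∘ suc) (allFin n)))
T-and-allFin-∷⁻ n f h = T-∧-elim {f zero} (≡.subst (T ∘ and) (map-allFin-suc n f) h)

T-and-allFin⁻ : ∀ n (f : Fin n → Bool) → T (and (map f (allFin n))) → ∀ i → T (f i)
T-and-allFin⁻ (suc n) f h zero    = proj₁ (T-and-allFin-∷⁻ n f h)
T-and-allFin⁻ (suc n) f h (suc i) = T-and-allFin⁻ n (f ∘ suc) (proj₂ (T-and-allFin-∷⁻ n f h)) i

T-and-allFin⁺ : ∀ n (f : Fin n → Bool) → (∀ i → T (f i)) → T (and (map f (allFin n)))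
T-and-allFin⁺ zero    f _ = tt
T-and-allFin⁺ (suc n) f h = ≡.subst (T ∘ and) (≡.sym (map-allFin-suc n f)) (T-∧-intro (h zero) (T-and-allFin⁺ n (f ∘ suc) (h ∘ suc)))

Proper : ∀ {n N} → (Fin n → Fin n → Bool) → Vec (Fin N) n → Set
Proper adj κ = ∀ i j → T (adj i j) → T (not (finEq (lookup κ i) (lookup κ j)))

proper⇒Proper : ∀ {n N} adj (κ : Vec (Fin N) n) → T (proper adj κ) → Proper adj κ
proper⇒Proper {n} adj κ h i j ij = edge (adj i j) (T-and-allFin⁻ n _ (T-and-allFin⁻ n _ h i) j) ij
  where
  edge : ∀ a {b} → T (not a ∨ b) → T a → T b
  edge true tb _ = tb

Proper⇒proper : ∀ {n N} adj (κ : Vec (Fin N) n) → Proper adj κ → T (proper adj κ)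
Proper⇒proper {n} adj κ h = T-and-allFin⁺ n _ λ i → T-and-allFin⁺ n _ λ j → edge (adj i j) (h i j)
  where
  edge : ∀ a {b} → (T a → T b) → T (not a ∨ b)
  edge true  f = f tt
  edge false _ = tt

smirnovWord : ∀ {n N} → Maybe (Fin N) → Maybe (Fin N) → Vec (Fin N) n → Bool
smirnovWord p q []      = apart p q
smirnovWord p q (a ∷ κ) = apart p (just a) ∧ smirnovWord (just a) q κ

smirnovWord-closed : ∀ {n N} (a q : Fin N) (κ : Vec (Fin N) n) →
  smirnovWord (just a) (just q) κ ≡ smirnovWord (just a) nothing κ ∧ not (finEq (last (a ∷ κ)) q)
smirnovWord-closed a q []      = refl
smirnovWord-closed a q (b ∷ κ) =
  ≡.trans (cong (not (finEq a b) ∧_) (smirnovWord-closed b q κ)) (≡.sym (∧-assoc (not (finEq a b)) _ _))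

Proper-path-∷ : ∀ {n N} (a b : Fin N) (κ : Vec (Fin N) n) →
  T (not (finEq a b)) → Proper (pathAdj (suc n)) (b ∷ κ) → Proper (pathAdj (suc (suc n))) (a ∷ b ∷ κ)
Proper-path-∷ a b κ a≢b rest zero          (suc zero) _  = a≢b
Proper-path-∷ a b κ a≢b rest (suc zero)    zero       _  = ≡.subst (T ∘ not) (finEq-sym a b) a≢b
Proper-path-∷ a b κ a≢b rest (suc i)       (suc j)    ij = rest i j ij
Proper-path-∷ a b κ a≢b rest zero          zero       ()
Proper-path-∷ a b κ a≢b rest zero          (suc (suc j)) ()
Proper-path-∷ a b κ a≢b rest (suc (suc i)) zero       ()

smirnovWord⇒Proper-path : ∀ {n N} (κ : Vec (Fin N) n) → T (smirnovWord nothing nothing κ) → Proper (pathAdj n) κ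
smirnovWord⇒Proper-path []          _ ()
smirnovWord⇒Proper-path (a ∷ [])    _ zero zero ()
smirnovWord⇒Proper-path (a ∷ b ∷ κ) h =
  Proper-path-∷ a b κ (proj₁ (T-∧-elim h)) (smirnovWord⇒Proper-path (b ∷ κ) (proj₂ (T-∧-elim h)))

Proper-path⇒smirnovWord : ∀ {n N} (κ : Vec (Fin N) n) → Proper (pathAdj n) κ → T (smirnovWord nothing nothing κ)
Proper-path⇒smirnovWord []          _ = tt
Proper-path⇒smirnovWord (a ∷ [])    _ = tt
Proper-path⇒smirnovWord (a ∷ b ∷ κ) h =
  T-∧-intro (h zero (suc zero) tt) (Proper-path⇒smirnovWord (b ∷ κ) λ i j → h (suc i) (suc j))

proper-path : ∀ {n N} (κ : Vec (Fin N) n) → proper (pathAdj n) κ ≡ smirnovWord nothing nothing κ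
proper-path κ = T-injective (Proper-path⇒smirnovWord κ ∘ proper⇒Proper _ κ) (Proper⇒proper _ κ ∘ smirnovWord⇒Proper-path κ)

toℕ≡ᵇ0⇒zero : ∀ {n} (i : Fin (suc n)) → T (toℕ i ≡ᵇ 0) → i ≡ zero
toℕ≡ᵇ0⇒zero zero _ = refl

lookup-last : ∀ {A : Set} {n} (v : Vec A (suc n)) (j : Fin (suc n)) → T (toℕ j ≡ᵇ n) → lookup v j ≡ last v
lookup-last (a ∷ [])    zero    _ = refl
lookup-last (a ∷ b ∷ v) (suc j) h = lookup-last (b ∷ v) j h

T-∨-introˡ : ∀ a {b} → T a → T (a ∨ b)
T-∨-introˡ true _ = tt

T-∨-introʳ : ∀ a {b} → T b → T (a ∨ b)
T-∨-introʳ true  _  = tt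
T-∨-introʳ false tb = tb

T-∨-elim : ∀ a {b} → T (a ∨ b) → T a ⊎ T b
T-∨-elim true  _  = inj₁ tt
T-∨-elim false tb = inj₂ tb

Proper-cycle⇒ : ∀ {n N} (v : Vec (Fin N) (suc n)) → Proper (cycleAdj (suc n)) v →
  Proper (pathAdj (suc n)) v × T (not (finEq (last v) (lookup v zero)))
Proper-cycle⇒ {n} v h = (λ i j ij → h i j (T-∨-introˡ (pathAdj (suc n) i j) ij)) ,
  ≡.subst (λ x → T (not (finEq x (lookup v zero)))) (lookup-last v (fromℕ n) closes) (h (fromℕ n) zero closing-edge)
  where
  closes : T (toℕ (fromℕ n) ≡ᵇ n)
  closes = ≡⇒≡ᵇ _ _ (toℕ-fromℕ n)
  closing-edge : T (cycleAdj (suc n) (fromℕ n) zero)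
  closing-edge = T-∨-introʳ (pathAdj (suc n) (fromℕ n) zero) (T-∨-introʳ ((toℕ (fromℕ n) ≡ᵇ 0) ∧ (1 ≡ᵇ suc n)) closes)

Proper-cycle⇐ : ∀ {n N} (v : Vec (Fin N) (suc n)) →
  Proper (pathAdj (suc n)) v → T (not (finEq (last v) (lookup v zero))) → Proper (cycleAdj (suc n)) v
Proper-cycle⇐ {n} v path closed i j ij with T-∨-elim (pathAdj (suc n) i j) ij
... | inj₁ p = path i j p
... | inj₂ e with T-∨-elim ((toℕ i ≡ᵇ 0) ∧ (suc (toℕ j) ≡ᵇ suc n)) e
...   | inj₁ first-last = let i₀ , jₗ = T-∧-elim first-last in
  ≡.subst (λ x → T (not (finEq (lookup v x) (lookup v j)))) (≡.sym (toℕ≡ᵇ0⇒zero i i₀))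
    (≡.subst (λ y → T (not (finEq (lookup v zero) y))) (≡.sym (lookup-last v j jₗ))
      (≡.subst (T ∘ not) (finEq-sym (last v) (lookup v zero)) closed))
...   | inj₂ last-first = let j₀ , iₗ = T-∧-elim last-first in
  ≡.subst (λ y → T (not (finEq (lookup v i) (lookup v y)))) (≡.sym (toℕ≡ᵇ0⇒zero j j₀))
    (≡.subst (λ x → T (not (finEq x (lookup v zero)))) (≡.sym (lookup-last v i iₗ)) closed)

proper-cycle : ∀ {n N} (c : Fin N) (κ : Vec (Fin N) n) → proper (cycleAdj (suc n)) (c ∷ κ) ≡ smirnovWord (just c) (just c) κ
proper-cycle c κ = T-injective
  (λ t → let path , closed = Proper-cycle⇒ (c ∷ κ) (proper⇒Proper _ (c ∷ κ) t) in
    ≡.subst T (≡.sym (smirnovWord-closed c c κ)) (T-∧-intro (Proper-path⇒smirnovWord (c ∷ κ) path) closed))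
  (λ t → let word , closed = T-∧-elim (≡.subst T (smirnovWord-closed c c κ) t) in
    Proper⇒proper _ (c ∷ κ) (Proper-cycle⇐ (c ∷ κ) (smirnovWord⇒Proper-path (c ∷ κ) word) closed))

module ChromaticSeries (N : ℕ) where

  open GeneratingSeries N
  open SmirnovSeries N
  open SmirnovIdentities N using (S; C)

  count-smirnovWord : ∀ n p q → count (smirnovWord {n} p q) ≗ smirnov p q n
  count-smirnovWord zero p q α = empty-word (apart p q)
    where
    empty-word : ∀ b → indicator (b ∧ vecEq (colorCount {0} {N} []) α) + 0 ≡ 𝕊Σ.when b oneS α
    empty-word true  = ≡.trans (+-identityʳ _) (cong indicator (vecEq-zero α))
    empty-word false = refl
  count-smirnovWord (suc n) p q α = begin
    count (smirnovWord {suc n} p q) α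
      ≡⟨ count-∷ (smirnovWord p q) α ⟩
    ℕΣ.sum (λ c → (x[ c ] ⊛ count {n} (λ κ → apart p (just c) ∧ smirnovWord (just c) q κ)) α)
      ≡⟨ ℕΣ.sum-cong-≗ (λ c → first-letter c (apart p (just c))) ⟩
    ℕΣ.sum (λ c → 𝕊Σ.when (apart p (just c)) (x[ c ] ⊛ smirnov (just c) q n) α)
      ≡⟨ ∑-at (λ c → 𝕊Σ.when (apart p (just c)) (x[ c ] ⊛ smirnov (just c) q n)) α ⟨
    smirnov p q (suc n) α ∎
    where
    open ≡.≡-Reasoning
    first-letter : ∀ c b → (x[ c ] ⊛ count {n} (λ κ → b ∧ smirnovWord (just c) q κ)) α
                           ≡ 𝕊Σ.when b (x[ c ] ⊛ smirnov (just c) q n) α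
    first-letter c true  = 𝕊.*-congˡ {x[ c ]} (count-smirnovWord n (just c) q) α
    first-letter c false = ≡.trans (𝕊.*-congˡ {x[ c ]} {count {n} λ _ → false} {zeroS} (λ _ → ℕΣ.Σˡ-zero (colorings n N)) α)
                                   (𝕊.zeroʳ x[ c ] α)

  X-path : ∀ l → X {N} l (pathAdj l) ≗ S l
  X-path l α = ≡.trans (X≗count l (pathAdj l) α)
    (≡.trans (count-cong {l} proper-path α) (count-smirnovWord l nothing nothing α))

  X-cycle : ∀ n → X {N} (suc n) (cycleAdj (suc n)) ≗ C (suc n)
  X-cycle n α = begin
    X (suc n) (cycleAdj (suc n)) α
      ≡⟨ X≗count (suc n) (cycleAdj (suc n)) α ⟩
    count (proper (cycleAdj (suc n))) α
      ≡⟨ count-∷ (proper (cycleAdj (suc n))) α ⟩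
    ℕΣ.sum (λ c → (x[ c ] ⊛ count (proper (cycleAdj (suc n)) ∘ (c ∷_))) α)
      ≡⟨ ℕΣ.sum-cong-≗ (λ c → 𝕊.*-congˡ {x[ c ]}
           (λ β → ≡.trans (count-cong {n} (proper-cycle c) β) (count-smirnovWord n (just c) (just c) β)) α) ⟩
    ℕΣ.sum (λ c → (x[ c ] ⊛ smirnov (just c) (just c) n) α)
      ≡⟨ ℕΣ.sum-cong-≗ (λ c → Z-⊠-suc c (smirnov (just c) (just c)) n α) ⟨
    ℕΣ.sum (λ c → (Z c ⊠ smirnov (just c) (just c)) (suc n) α)
      ≡⟨ ∑-at (λ c → (Z c ⊠ smirnov (just c) (just c)) (suc n)) α ⟨
    𝕊Σ.sum (λ c → (Z c ⊠ smirnov (just c) (just c)) (suc n)) α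
      ≡⟨ cong (_$ α) (∑-coeff (λ c → Z c ⊠ smirnov (just c) (just c)) (suc n)) ⟨
    C (suc n) α ∎
    where open ≡.≡-Reasoning

-- The statistic Θ⁺

-- σ⁺ K c unfolds to minAbove c (sum K) (partialSums K).
minAbove : ℕ → ℕ → List ℕ → ℕ
minAbove c = foldr λ p r → if c ≤ᵇ p then p ⊓ r else r

partialSums-∷ : ∀ x K → partialSums (x ∷ K) ≡ 0 ∷ map (x +_) (partialSums K)
partialSums-∷ x []      = cong (λ y → 0 ∷ [ y ]) (≡.sym (+-identityʳ x))
partialSums-∷ x (y ∷ K) = cong (0 ∷_) (cong₂ _∷_ (≡.sym (+-identityʳ x)) (begin
  drop 1 (partialSums (x + y ∷ K))         ≡⟨ cong (drop 1) (partialSums-∷ (x + y) K) ⟩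
  map (x + y +_) (partialSums K)         ≡⟨ List.map-cong (+-assoc x y) (partialSums K) ⟩
  map ((x +_) ∘ (y +_)) (partialSums K)  ≡⟨ List.map-∘ (partialSums K) ⟩
  map (x +_) (map (y +_) (partialSums K)) ≡⟨ cong (map (x +_) ∘ drop 1) (partialSums-∷ y K) ⟨
  map (x +_) (drop 1 (partialSums (y ∷ K))) ∎))
  where open ≡.≡-Reasoning

suc≤ᵇsuc : ∀ a b → (suc a ≤ᵇ suc b) ≡ (a ≤ᵇ b)
suc≤ᵇsuc zero    b = refl
suc≤ᵇsuc (suc a) b = refl

≤ᵇ-+ˡ : ∀ x c p → (x + c ≤ᵇ x + p) ≡ (c ≤ᵇ p)
≤ᵇ-+ˡ zero    c p = refl
≤ᵇ-+ˡ (suc x) c p = ≡.trans (suc≤ᵇsuc (x + c) (x + p)) (≤ᵇ-+ˡ x c p)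

minAbove-+ˡ : ∀ x c init L → minAbove (x + c) (x + init) (map (x +_) L) ≡ x + minAbove c init L
minAbove-+ˡ x c init []      = refl
minAbove-+ˡ x c init (p ∷ L) rewrite ≤ᵇ-+ˡ x c p with c ≤ᵇ p
... | true  = ≡.trans (cong ((x + p) ⊓_) (minAbove-+ˡ x c init L)) (≡.sym (+-distribˡ-⊓ x p _))
... | false = minAbove-+ˡ x c init L

σ⁺-∷ : ∀ x K c → σ⁺ (x ∷ K) (suc c) ≡ minAbove (suc c) (x + ℕ.sum K) (map (x +_) (partialSums K))
σ⁺-∷ x K c = cong (minAbove (suc c) (x + ℕ.sum K)) (partialSums-∷ x K)

Θ⁺-zero : ∀ K → Θ⁺ K 0 ≡ 0
Θ⁺-zero []      = refl
Θ⁺-zero (_ ∷ _) = refl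

Θ⁺-1∷ : ∀ K c → Θ⁺ (1 ∷ K) (suc c) ≡ Θ⁺ K c
Θ⁺-1∷ K c = cong (_∸ suc c) (≡.trans (σ⁺-∷ 1 K c) (minAbove-+ˡ 1 c (ℕ.sum K) (partialSums K)))

Θ⁺-suc∷ : ∀ k K c → Θ⁺ (suc k ∷ K) (suc (suc c)) ≡ Θ⁺ (k ∷ K) (suc c)
Θ⁺-suc∷ k K c = cong (_∸ suc (suc c)) (begin
  σ⁺ (suc k ∷ K) (suc (suc c))
    ≡⟨ σ⁺-∷ (suc k) K (suc c) ⟩
  minAbove (suc (suc c)) (suc k + ℕ.sum K) (map (suc k +_) (partialSums K))
    ≡⟨ cong (minAbove (suc (suc c)) (suc k + ℕ.sum K)) (List.map-∘ (partialSums K)) ⟩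
  minAbove (1 + suc c) (1 + (k + ℕ.sum K)) (map (1 +_) (map (k +_) (partialSums K)))
    ≡⟨ minAbove-+ˡ 1 (suc c) (k + ℕ.sum K) (map (k +_) (partialSums K)) ⟩
  1 + minAbove (suc c) (k + ℕ.sum K) (map (k +_) (partialSums K))
    ≡⟨ cong (1 +_) (σ⁺-∷ k K c) ⟨
  1 + σ⁺ (k ∷ K) (suc c) ∎)
  where open ≡.≡-Reasoning

minAbove-lower : ∀ c j s L → j ≤ minAbove c (j + s) (map (j +_) L)
minAbove-lower c j s []      = m≤m+n j s
minAbove-lower c j s (p ∷ L) with c ≤ᵇ j + p
... | true  = ⊓-glb (m≤m+n j p) (minAbove-lower c j s L)
... | false = minAbove-lower c j s L

Θ⁺-first : ∀ j J → Θ⁺ (suc j ∷ J) 1 ≡ j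
Θ⁺-first j J = cong (_∸ 1) (begin
  σ⁺ (suc j ∷ J) 1
    ≡⟨ ≡.trans (σ⁺-∷ (suc j) J 0) (cong (minAbove 1 (suc j + ℕ.sum J)) (List.map-∘ (partialSums J))) ⟩
  minAbove (1 + 0) (1 + (j + ℕ.sum J)) (map (1 +_) (map (j +_) (partialSums J)))
    ≡⟨ minAbove-+ˡ 1 0 (j + ℕ.sum J) (map (j +_) (partialSums J)) ⟩
  1 + minAbove 0 (j + ℕ.sum J) (map (j +_) (partialSums J))
    ≡⟨ cong (1 +_) (first-sum (partialSums J) (partialSums-head J)) ⟩
  1 + j ∎)
  where
  open ≡.≡-Reasoning
  partialSums-head : ∀ J → partialSums J ≡ 0 ∷ drop 1 (partialSums J)
  partialSums-head []      = refl
  partialSums-head (_ ∷ _) = refl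
  first-sum : ∀ L → L ≡ 0 ∷ drop 1 L → minAbove 0 (j + ℕ.sum J) (map (j +_) L) ≡ j
  first-sum (.0 ∷ L) refl = ≡.trans (cong (_⊓ minAbove 0 (j + ℕ.sum J) (map (j +_) L)) (+-identityʳ j))
    (m≤n⇒m⊓n≡m (minAbove-lower 0 j (ℕ.sum J) L))

PositiveHead : List ℕ → Set
PositiveHead K = ∃₂ λ k K′ → K ≡ suc k ∷ K′

All-raiseHead⁺ : ∀ {P Q : List ℕ → Set} {X} →
  All P X → (∀ i I → P (i ∷ I) → Q (suc i ∷ I)) → All Q (concatMap raiseHead X)
All-raiseHead⁺ []                 f = []
All-raiseHead⁺ {X = [] ∷ _}      (_ ∷ ps) f = All-raiseHead⁺ ps f
All-raiseHead⁺ {X = (i ∷ I) ∷ _} (p ∷ ps) f = f i I p ∷ All-raiseHead⁺ ps f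

All-compositions-suc⁺ : ∀ {P Q : List ℕ → Set} n → All P (compositions n) →
  (∀ I → P I → Q (1 ∷ I)) → (∀ i I → P (i ∷ I) → Q (suc i ∷ I)) → All Q (compositions (suc n))
All-compositions-suc⁺ n ps new raise = ≡.subst (All _) (≡.sym (compositions-suc n))
  (Allₚ.++⁺ (Allₚ.map⁺ (All.map (new _) ps)) (All-raiseHead⁺ ps raise))

compositions-positiveHead : ∀ n → All PositiveHead (compositions (suc n))
compositions-positiveHead n = All-compositions-suc⁺ n (All.universal (λ _ → tt) (compositions n))
  (λ I _ → 0 , I , refl) (λ i I _ → i , I , refl)

-- For I ⊨ l and J ⊨ m + 1, the least partial sum of IJ reaching l + 1 is l + j₁.
Θ⁺-++ : ∀ l m → All (λ I → All (λ J → Θ⁺ (I ++ J) (suc l) + 1 ≡ firstPart J) (compositions (suc m))) (compositions l)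
Θ⁺-++ zero    m = All.map first (compositions-positiveHead m) ∷ []
  where
  first : ∀ {J} → PositiveHead J → Θ⁺ J 1 + 1 ≡ firstPart J
  first (j , J , refl) = ≡.trans (cong (_+ 1) (Θ⁺-first j J)) (+-comm j 1)
Θ⁺-++ (suc l) m = All-compositions-suc⁺ l (Θ⁺-++ l m)
  (λ I → All.map λ {J} eq → ≡.trans (cong (_+ 1) (Θ⁺-1∷ (I ++ J) (suc l))) eq)
  (λ i I → All.map λ {J} eq → ≡.trans (cong (_+ 1) (Θ⁺-suc∷ i (I ++ J) l)) eq)

splitsAt : ℕ → List ℕ → Bool
splitsAt l K = Θ⁺ K l ≡ᵇ 0

appendTo : ℕ → List ℕ → List (List ℕ)
appendTo m I = map (I ++_) (compositions m)

filterᵇ-map : ∀ {A : Set} {p q : A → Bool} (f : A → A) → (∀ x → p (f x) ≡ q x) → ∀ xs →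
  filterᵇ p (map f xs) ≡ map f (filterᵇ q xs)
filterᵇ-map f eq []       = refl
filterᵇ-map {p = p} {q} f eq (x ∷ xs) with p (f x) | q x | eq x
... | true  | true  | _ = cong (f x ∷_) (filterᵇ-map f eq xs)
... | false | false | _ = filterᵇ-map f eq xs

filterᵇ-raiseHead : ∀ {p q : List ℕ → Bool} → (∀ k K → p (suc k ∷ K) ≡ q (k ∷ K)) → ∀ X →
  filterᵇ p (concatMap raiseHead X) ≡ concatMap raiseHead (filterᵇ q X)
filterᵇ-raiseHead eq [] = refl
filterᵇ-raiseHead {q = q} eq ([] ∷ X) with q []
... | true  = filterᵇ-raiseHead eq X
... | false = filterᵇ-raiseHead eq X
filterᵇ-raiseHead {p} {q} eq ((k ∷ K) ∷ X) with p (suc k ∷ K) | q (k ∷ K) | eq k K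
... | true  | true  | _ = cong ((suc k ∷ K) ∷_) (filterᵇ-raiseHead eq X)
... | false | false | _ = filterᵇ-raiseHead eq X

raiseHead-appendTo : ∀ m L → All PositiveHead L →
  concatMap raiseHead (concatMap (appendTo m) L) ≡ concatMap (appendTo m) (concatMap raiseHead L)
raiseHead-appendTo m [] [] = refl
raiseHead-appendTo m ((suc i ∷ I) ∷ L) ((_ , _ , refl) ∷ ps) = begin
  concatMap raiseHead (appendTo m (suc i ∷ I) ++ concatMap (appendTo m) L)
    ≡⟨ List.concatMap-++ raiseHead (appendTo m (suc i ∷ I)) _ ⟩
  concatMap raiseHead (appendTo m (suc i ∷ I)) ++ concatMap raiseHead (concatMap (appendTo m) L)
    ≡⟨ cong₂ _++_ (raised (compositions m)) (raiseHead-appendTo m L ps) ⟩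
  concatMap (appendTo m) ((suc (suc i) ∷ I) ∷ concatMap raiseHead L) ∎
  where
  open ≡.≡-Reasoning
  raised : ∀ Js → concatMap raiseHead (map ((suc i ∷ I) ++_) Js) ≡ map ((suc (suc i) ∷ I) ++_) Js
  raised []       = refl
  raised (J ∷ Js) = cong ((suc (suc i) ∷ I ++ J) ∷_) (raised Js)

splitting-new : ∀ m l → filterᵇ (splitsAt l) (compositions (l + suc m)) ≡ concatMap (appendTo (suc m)) (compositions l) →
  filterᵇ (splitsAt (suc l)) (map (1 ∷_) (compositions (l + suc m)))
    ≡ concatMap (appendTo (suc m)) (map (1 ∷_) (compositions l))
splitting-new m l splitting = begin
  filterᵇ (splitsAt (suc l)) (map (1 ∷_) (compositions (l + suc m)))
    ≡⟨ filterᵇ-map (1 ∷_) (λ K → cong (_≡ᵇ 0) (Θ⁺-1∷ K l)) (compositions (l + suc m)) ⟩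
  map (1 ∷_) (filterᵇ (splitsAt l) (compositions (l + suc m)))
    ≡⟨ cong (map (1 ∷_)) splitting ⟩
  map (1 ∷_) (concatMap (appendTo (suc m)) (compositions l))
    ≡⟨ List.map-concatMap (1 ∷_) (appendTo (suc m)) (compositions l) ⟩
  concatMap (map (1 ∷_) ∘ appendTo (suc m)) (compositions l)
    ≡⟨ List.concatMap-cong (λ I → List.map-∘ (compositions (suc m))) (compositions l) ⟨
  concatMap (appendTo (suc m) ∘ (1 ∷_)) (compositions l)
    ≡⟨ List.concatMap-map (appendTo (suc m)) (1 ∷_) (compositions l) ⟨
  concatMap (appendTo (suc m)) (map (1 ∷_) (compositions l)) ∎
  where open ≡.≡-Reasoning

splitting-raised : ∀ m l → filterᵇ (splitsAt l) (compositions (l + suc m)) ≡ concatMap (appendTo (suc m)) (compositions l) →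
  filterᵇ (splitsAt (suc l)) (concatMap raiseHead (compositions (l + suc m)))
    ≡ concatMap (appendTo (suc m)) (concatMap raiseHead (compositions l))
splitting-raised m zero    _         = List.filter-none (T? ∘ splitsAt 1)
  (All-raiseHead⁺ (compositions-positiveHead m) λ { i I (k , K , refl) → ≡.subst T (cong (_≡ᵇ 0) (Θ⁺-first (suc k) I)) })
splitting-raised m (suc l) splitting = begin
  filterᵇ (splitsAt (suc (suc l))) (concatMap raiseHead (compositions (suc l + suc m)))
    ≡⟨ filterᵇ-raiseHead (λ k K → cong (_≡ᵇ 0) (Θ⁺-suc∷ k K l)) (compositions (suc l + suc m)) ⟩
  concatMap raiseHead (filterᵇ (splitsAt (suc l)) (compositions (suc l + suc m)))
    ≡⟨ cong (concatMap raiseHead) splitting ⟩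
  concatMap raiseHead (concatMap (appendTo (suc m)) (compositions (suc l)))
    ≡⟨ raiseHead-appendTo (suc m) (compositions (suc l)) (compositions-positiveHead l) ⟩
  concatMap (appendTo (suc m)) (concatMap raiseHead (compositions (suc l))) ∎
  where open ≡.≡-Reasoning

-- Θ⁺_K(l) = 0 exactly when l is a partial sum of K, that is, when K = IJ with I ⊨ l.
compositions-splitting : ∀ m l → filterᵇ (splitsAt l) (compositions (l + suc m)) ≡ concatMap (appendTo (suc m)) (compositions l)
compositions-splitting m zero = begin
  filterᵇ (splitsAt 0) (compositions (suc m))
    ≡⟨ List.filter-all (T? ∘ splitsAt 0) (All.universal (λ K → ≡.subst T (cong (_≡ᵇ 0) (≡.sym (Θ⁺-zero K))) tt) _) ⟩
  compositions (suc m)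
    ≡⟨ List.map-id (compositions (suc m)) ⟨
  map ([] ++_) (compositions (suc m))
    ≡⟨ List.++-identityʳ _ ⟨
  concatMap (appendTo (suc m)) [ [] ] ∎
  where open ≡.≡-Reasoning
compositions-splitting m (suc l) = begin
  filterᵇ (splitsAt (suc l)) (compositions (suc (l + suc m)))
    ≡⟨ cong (filterᵇ (splitsAt (suc l))) (compositions-suc (l + suc m)) ⟩
  filterᵇ (splitsAt (suc l)) (map (1 ∷_) Ks ++ concatMap raiseHead Ks)
    ≡⟨ List.filter-++ (T? ∘ splitsAt (suc l)) (map (1 ∷_) Ks) (concatMap raiseHead Ks) ⟩
  filterᵇ (splitsAt (suc l)) (map (1 ∷_) Ks) ++ filterᵇ (splitsAt (suc l)) (concatMap raiseHead Ks)
    ≡⟨ cong₂ _++_ (splitting-new m l (compositions-splitting m l)) (splitting-raised m l (compositions-splitting m l)) ⟩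
  concatMap (appendTo (suc m)) (map (1 ∷_) (compositions l)) ++ concatMap (appendTo (suc m)) (concatMap raiseHead (compositions l))
    ≡⟨ List.concatMap-++ (appendTo (suc m)) (map (1 ∷_) (compositions l)) _ ⟨
  concatMap (appendTo (suc m)) (map (1 ∷_) (compositions l) ++ concatMap raiseHead (compositions l))
    ≡⟨ cong (concatMap (appendTo (suc m))) (compositions-suc l) ⟨
  concatMap (appendTo (suc m)) (compositions (suc l)) ∎
  where
  open ≡.≡-Reasoning
  Ks : List (List ℕ)
  Ks = compositions (l + suc m)

-- The three sums

w-++ : ∀ i I J → w (i ∷ I) * ((firstPart J ∸ 1) * w J) ≡ firstPart J * w ((i ∷ I) ++ J)
w-++ i I []      = *-zeroʳ (w (i ∷ I))
w-++ i I (j ∷ J) = begin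
  (i * t I) * ((j ∸ 1) * (j * t J))
    ≡⟨ solve 5 (λ i a b j c → (i :* a) :* (b :* (j :* c)) := j :* (i :* (a :* (b :* c)))) refl i (t I) (j ∸ 1) j (t J) ⟩
  j * (i * (t I * ((j ∸ 1) * t J)))
    ≡⟨ cong (λ x → j * (i * x)) (product-++ (map (_∸ 1) I) (map (_∸ 1) (j ∷ J))) ⟨
  j * (i * ℕ.product (map (_∸ 1) I ++ map (_∸ 1) (j ∷ J)))
    ≡⟨ cong (λ x → j * (i * ℕ.product x)) (List.map-++ (_∸ 1) I (j ∷ J)) ⟨
  j * w ((i ∷ I) ++ j ∷ J) ∎
  where
  open ≡.≡-Reasoning
  open +-*-Solver
  t : List ℕ → ℕ
  t K = ℕ.product (map (_∸ 1) K)

module ThreeSums (N : ℕ) where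

  open GeneratingSeries N
  open SmirnovIdentities N using (S; C)
  open CompositionSeries N using (ePath; eCycle; wTerm; cycleTerm)
  open SeriesIdentities N using (S≋ePath; C≋eCycle)
  open ChromaticSeries N using (X-path; X-cycle)
  open 𝕊Σ using (Σˡ; Σˡ-cong; Σˡ-cong-local; Σˡ-concatMap; Σˡ-map-concatMap; *-distribˡ-Σˡ; *-distribʳ-Σˡ)

  eC-++ : ∀ I J → eC I ⊛ eC J ≗ eC {N} (I ++ J)
  eC-++ []      J = 𝕊.*-identityˡ (eC J)
  eC-++ (i ∷ I) J = 𝕊.trans (𝕊.*-assoc (e i) (eC I) (eC J)) (𝕊.*-congˡ {e i} (eC-++ I J))

  term : List ℕ → List ℕ → Series N
  term I J = (firstPart J * w (I ++ J)) · eC (I ++ J)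

  doubleSum : ℕ → ℕ → Series N
  doubleSum l m = Σˡ (map (λ I → Σˡ (map (term I) (compositions m))) (compositions l))

  middleSum≗ : ∀ l m → middleSum l m ≗ doubleSum l m
  middleSum≗ l m = Σˡ-concatMap (λ I → map (term I) (compositions m)) (compositions l)

  XPC≗doubleSum : ∀ l m → XPC (suc l) (suc m) ≗ doubleSum (suc l) (suc m)
  XPC≗doubleSum l m = begin
    X (suc l) (pathAdj (suc l)) ⊛ X (suc m) (cycleAdj (suc m))
      ≈⟨ 𝕊.*-cong (𝕊.trans (X-path (suc l)) (S≋ePath (suc l))) (𝕊.trans (X-cycle m) (C≋eCycle (suc m))) ⟩
    ePath (suc l) ⊛ eCycle (suc m)
      ≈⟨ *-distribʳ-Σˡ (eCycle (suc m)) wTerm (compositions (suc l)) ⟩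
    Σˡ (map (λ I → wTerm I ⊛ eCycle (suc m)) (compositions (suc l)))
      ≈⟨ Σˡ-cong-local (All.map (λ {I} positive → 𝕊.trans (*-distribˡ-Σˡ (wTerm I) cycleTerm (compositions (suc m)))
                                      (Σˡ-cong (product-term positive) (compositions (suc m))))
                                (compositions-positiveHead l)) ⟩
    doubleSum (suc l) (suc m) ∎
    where
    open import Relation.Binary.Reasoning.Setoid 𝕊.setoid
    product-term : ∀ {I} → PositiveHead I → ∀ J → wTerm I ⊛ cycleTerm J 𝕊.≈ term I J
    product-term (i , I , refl) J = 𝕊.trans (scale-⊛-scale (w (suc i ∷ I)) _ (eC (suc i ∷ I)) (eC J))
      (λ α → cong₂ _*_ (w-++ (suc i) I J) (eC-++ (suc i ∷ I) J α))

  rightSum≗doubleSum : ∀ l m → rightSum l (suc m) ≗ doubleSum l (suc m)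
  rightSum≗doubleSum l m = begin
    Σˡ (map g (filterᵇ (splitsAt l) (compositions (l + suc m))))
      ≡⟨ cong (Σˡ ∘ map g) (compositions-splitting m l) ⟩
    Σˡ (map g (concatMap (appendTo (suc m)) (compositions l)))
      ≈⟨ Σˡ-map-concatMap g (appendTo (suc m)) (compositions l) ⟩
    Σˡ (map (λ I → Σˡ (map g (map (I ++_) (compositions (suc m))))) (compositions l))
      ≈⟨ Σˡ-cong-local (All.map (λ {I} Θ-values → 𝕊.trans
           (𝕊.reflexive (cong Σˡ (≡.sym (List.map-∘ (compositions (suc m))))))
           (Σˡ-cong-local (All.map (λ {J} eq α → cong (λ k → k * w (I ++ J) * eC (I ++ J) α) eq) Θ-values)))
         (Θ⁺-++ l m)) ⟩
    doubleSum l (suc m) ∎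
    where
    open import Relation.Binary.Reasoning.Setoid 𝕊.setoid
    g : List ℕ → Series N
    g K = ((Θ⁺ K (suc l) + 1) * w K) · eC K

lemma2p10 : (l m : ℕ) → 1 ≤ l → 2 ≤ m → (N : ℕ) → (α : Vec ℕ N) →
    (XPC l m α ≡ middleSum l m α) × (middleSum l m α ≡ rightSum l m α)
lemma2p10 (suc l) (suc m) (s≤s _) (s≤s _) N α =
  ≡.trans (XPC≗doubleSum l m α) (≡.sym (middleSum≗ (suc l) (suc m) α)) ,
  ≡.trans (middleSum≗ (suc l) (suc m) α) (≡.sym (rightSum≗doubleSum (suc l) m α))
  where open ThreeSums N
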